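{- Let $\mathcal{A}\subseteq\mathbb{F}_q^{3\times 3}$ be an $\mathbb{F}_q$-linear $(3,3,2)$ MRD code, i.e. an $\mathbb{F}_q$-subspace of size $q^6$ whose nonzero members all have rank $\ge 2$. Let $S=\langle\mathbf{e}_4,\mathbf{e}_5,\mathbf{e}_6\rangle\subseteq\mathbb{F}_q^6$, let $\mathbf{Z}\in\mathbb{F}_q^{2\times 3}$ be a matrix of rank $2$ in reduced row echelon form, and let $H$ be the $5$-dimensional subspace of $\mathbb{F}_q^6$ with canonical matrix $\begin{pmatrix}\mathbf{Z}&\mathbf{0}\\ \mathbf{0}&\mathbf{I}_3\end{pmatrix}$ (so $S\subseteq H$). For $\mathcal{R}\subseteq\mathcal{A}$ put $\mathcal{L}_1=\{\langle(\mathbf{I}_3|\mathbf{A})\rangle:\mathbf{A}\in\mathcal{R}\}$ and $\mathcal{L}_1\cap H=\{E\cap H:E\in\mathcal{L}_1\}$. Then the following are equivalent: (i) $\mathcal{L}_1\cap H$ is exactly the set of the $q^2$ two-dimensional subspaces $L$ of some $3$-dimensional subspace $N$ with $\dim(N\cap S)=1$ satisfying $L\cap S=\{\mathbf{0}\}$; (ii) $\mathbf{Z}\mathcal{R}=\{\mathbf{Z}\mathbf{A}:\mathbf{A}\in\mathcal{R}\}$ is a line of $\mathrm{AG}_\ell(2,3,q)$; (iii) $\mathcal{R}=\mathbf{A}_0+\mathcal{D}$ for some $\mathbf{A}_0\in\mathcal{A}$ and some $2$-dimensional $\mathbb{F}_q$-subspace $\mathcal{D}$ of $\mathcal{A}$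 such that every nonzero member of $\mathcal{D}$ has rank exactly $2$, and the ($1$-dimensional) left kernels of the nonzero members of $\mathcal{D}$ generate the row space $\langle\mathbf{Z}\rangle$. If these conditions hold, then $N$ has canonical matrix $\begin{pmatrix}\mathbf{Z}&\mathbf{Z}\mathbf{A}_0\\ \mathbf{0}&\mathbf{s}\end{pmatrix}$, where $\mathbf{s}\in\mathbb{F}_q^3$ generates the common $1$-dimensional row space of the nonzero matrices in $\mathbf{Z}\mathcal{D}$; moreover $\mathbb{F}_q\mathbf{s}$ (identified with $N\cap S$ after padding with three leading zeros) is the point at infinity of the line $\mathbf{Z}\mathcal{R}$.
   Context: $\mathbf{e}_i$ are standard unit vectors, $\langle\cdot\rangle$ denotes row space, and the canonical matrix of a subspace is its unique generator matrix in reduced row echelon form without zero rows. The left affine geometry $\mathrm{AG}_\ell(2,3,q)$ has point set $\mathbb{F}_q^{2\times 3}$; its lines are the cosets $\mathbf{B}+\mathcal{U}$ with $\mathbf{B}\in\mathbb{F}_q^{2\times 3}$ and $\mathcal{U}=\{\mathbf{U}\in\mathbb{F}_q^{2\times 3}:\langle\mathbf{U}\rangle\subseteq W\}$ for a fixed $1$-dimensional subspace $W$ of $\mathbb{F}_q^3$; $W$ is called the point at infinity of the line. The left kernel of a rank-$2$ matrix $\mathbf{A}\in\mathbb{F}_q^{3\times3}$ is $\{\mathbf{z}\in\mathbb{F}_q^3:\mathbf{z}\mathbf{A}=\mathbf{0}\}$. -}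

module Defs where

open import Level using (0ℓ)
open import Data.Nat as ℕ using (ℕ; zero; suc; _^_; _≤_)
open import Data.Fin as Fin using (Fin; splitAt; _<_)
open import Data.Sum using (_⊎_; inj₁; inj₂)
open import Data.Product using (Σ; ∃; ∃-syntax; _×_; _,_)
open import Data.List using (List; length)
open import Data.List.Membership.Propositional using (_∈_)
open import Data.List.Relation.Unary.Unique.Propositional using (Unique)
open import Relation.Nullary using (¬_; Dec; yes; no)
open import Relation.Unary using (Pred)
open import Relation.Binary.PropositionalEquality using (_≡_)
open import Algebra.Structures using (IsCommutativeRing)

record FiniteField : Set₁ where
  field
    F          : Set
    _+_ _*_    : F → F → F
    -_         : F → F
    0# 1#      : F
    isCommRing : IsCommutativeRing _≡_ _+_ _*_ -_ 0# 1#
    0≢1        : ¬ (0# ≡ 1#)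
    inverse    : ∀ x → ¬ (x ≡ 0#) → ∃[ y ] (x * y ≡ 1#)
    _≟_        : (x y : F) → Dec (x ≡ y)
    elements   : List F
    complete   : ∀ x → x ∈ elements
    unique     : Unique elements

  q : ℕ
  q = length elements

module Over (K : FiniteField) where
  open FiniteField K public

  infix 4 _≈_ _≈ₘ_ _≐_

  Vect : ℕ → Set
  Vect n = Fin n → F

  Mat : ℕ → ℕ → Set
  Mat m n = Fin m → Fin n → F

  ∑ : ∀ {n} → (Fin n → F) → F
  ∑ {zero}  f = 0#
  ∑ {suc n} f = f Fin.zero + ∑ (λ i → f (Fin.suc i))

  _≈_ : ∀ {n} → Vect n → Vect n → Set
  u ≈ v = ∀ i → u i ≡ v i

  _≈ₘ_ : ∀ {m n} → Mat m n → Mat m n → Set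
  M ≈ₘ N = ∀ i j → M i j ≡ N i j

  0v : ∀ {n} → Vect n
  0v _ = 0#

  0ₘ : ∀ {m n} → Mat m n
  0ₘ _ _ = 0#

  Iₘ : ∀ {n} → Mat n n
  Iₘ i j with i Fin.≟ j
  ... | yes _ = 1#
  ... | no  _ = 0#

  _·_ : ∀ {m n} → Vect m → Mat m n → Vect n
  (c · M) j = ∑ (λ i → c i * M i j)

  _⊗_ : ∀ {m k n} → Mat m k → Mat k n → Mat m n
  (M ⊗ N) i j = ∑ (λ t → M i t * N t j)

  _+ₘ_ : ∀ {m n} → Mat m n → Mat m n → Mat m n
  (M +ₘ N) i j = M i j + N i j

  _•ₘ_ : ∀ {m n} → F → Mat m n → Mat m n
  (a •ₘ M) i j = a * M i j

  lincombₘ : ∀ {k m n} → Vect k → (Fin k → Mat m n) → Mat m n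
  lincombₘ c Ms i j = ∑ (λ t → c t * Ms t i j)

  row : ∀ {n} → Vect n → Mat 1 n
  row s _ = s

  hcat : ∀ {m k l} → Mat m k → Mat m l → Mat m (k ℕ.+ l)
  hcat {k = k} M N i j with splitAt k j
  ... | inj₁ j₁ = M i j₁
  ... | inj₂ j₂ = N i j₂

  vcat : ∀ {m n k} → Mat m k → Mat n k → Mat (m ℕ.+ n) k
  vcat {m = m} M N i j with splitAt m i
  ... | inj₁ i₁ = M i₁ j
  ... | inj₂ i₂ = N i₂ j

  Subset : ℕ → Set₁
  Subset n = Pred (Vect n) 0ℓ

  ⟨_⟩ : ∀ {m n} → Mat m n → Subset n
  ⟨ M ⟩ v = ∃[ c ] (v ≈ c · M)

  _∩_ : ∀ {n} → Subset n → Subset n → Subset n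
  (P ∩ Q) v = P v × Q v

  _⊆_ : ∀ {n} → Subset n → Subset n → Set
  P ⊆ Q = ∀ v → P v → Q v

  _≐_ : ∀ {n} → Subset n → Subset n → Set
  P ≐ Q = ∀ v → (P v → Q v) × (Q v → P v)

  RowsIndependent : ∀ {k n} → Mat k n → Set
  RowsIndependent B = ∀ c → (c · B) ≈ 0v → c ≈ 0v

  HasDim : ∀ {n} → Subset n → ℕ → Set
  HasDim {n} P k = ∃[ B ] (RowsIndependent {k} {n} B × P ≐ ⟨ B ⟩)

  HasRank : ∀ {m n} → Mat m n → ℕ → Set
  HasRank M r = HasDim ⟨ M ⟩ r

  RankAtLeast : ∀ {m n} → Mat m n → ℕ → Set
  RankAtLeast M r = ∃[ k ] (r ≤ k × HasRank M k)

  Span : ∀ {n} → Subset n → Subset n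
  Span P v = ∃[ k ] ∃[ w ] ((∀ i → P (w i)) × ⟨_⟩ {k} w v)

  LeftKer : ∀ {m n} → Mat m n → Subset m
  LeftKer A z = (z · A) ≈ 0v

  IsRREF : ∀ {m n} → Mat m n → Set
  IsRREF {m} {n} M =
    Σ (Fin m → Fin n) λ p → ( (∀ (i i' : Fin m) → i < i' → p i < p i')
           × (∀ i → M i (p i) ≡ 1#)
           × (∀ i i' → ¬ (i ≡ i') → M i' (p i) ≡ 0#)
           × (∀ i j → j < p i → M i j ≡ 0#) )

  MatSet : ℕ → ℕ → Set₁
  MatSet m n = Pred (Mat m n) 0ℓ

  RespectsMat : ∀ {m n} → MatSet m n → Set
  RespectsMat P = ∀ {M N} → M ≈ₘ N → P M → P N

  _⊆ₘ_ : ∀ {m n} → MatSet m n → MatSet m n → Set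
  P ⊆ₘ Q = ∀ M → P M → Q M

  HasSize : ∀ {m n} → MatSet m n → ℕ → Set
  HasSize {m} {n} P s =
    Σ (Fin s → Mat m n) λ enum → ( (∀ (t : Fin s) → P (enum t))
              × (∀ t t' → enum t ≈ₘ enum t' → t ≡ t')
              × (∀ M → P M → ∃[ t ] (M ≈ₘ enum t)) )

  IsLinearMatSubspace : ∀ {m n} → MatSet m n → Set
  IsLinearMatSubspace P =
    RespectsMat P × P 0ₘ × (∀ M N → P M → P N → P (M +ₘ N))
    × (∀ a M → P M → P (a •ₘ M))

  IsLinearMRD332 : MatSet 3 3 → Set
  IsLinearMRD332 𝒜 =
    IsLinearMatSubspace 𝒜 × HasSize 𝒜 (q ^ 6)
    × (∀ M → 𝒜 M → ¬ (M ≈ₘ 0ₘ) → RankAtLeast M 2)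

  MatSpan : ∀ {k m n} → (Fin k → Mat m n) → MatSet m n
  MatSpan Ms M = ∃[ c ] (M ≈ₘ lincombₘ c Ms)

  MatsIndependent : ∀ {k m n} → (Fin k → Mat m n) → Set
  MatsIndependent Ms = ∀ c → lincombₘ c Ms ≈ₘ 0ₘ → c ≈ 0v

  Smat : Mat 3 6
  Smat = hcat {k = 3} 0ₘ Iₘ

  S : Subset 6
  S = ⟨ Smat ⟩

  Hmat : Mat 2 3 → Mat 5 6
  Hmat Z = vcat (hcat {k = 3} Z 0ₘ) (hcat {k = 3} 0ₘ Iₘ)

  H : Mat 2 3 → Subset 6
  H Z = ⟨ Hmat Z ⟩

  E : Mat 3 3 → Subset 6
  E A = ⟨ hcat {k = 3} Iₘ A ⟩

  ZR : Mat 2 3 → MatSet 3 3 → MatSet 2 3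
  ZR Z 𝓡 M = ∃[ A ] (𝓡 A × M ≈ₘ (Z ⊗ A))

  -- 𝒳 is the line B + 𝒰 of AG_ℓ(2,3,q), with point at infinity W
  -- (W a 1-dimensional subspace of F^3)
  IsLineWith : MatSet 2 3 → Mat 2 3 → Subset 3 → Set
  IsLineWith 𝒳 B W =
    HasDim W 1 × (∀ M → (𝒳 M → ∃[ U ] (⟨ U ⟩ ⊆ W × M ≈ₘ (B +ₘ U)))
                      × (∃[ U ] (⟨ U ⟩ ⊆ W × M ≈ₘ (B +ₘ U)) → 𝒳 M))

  IsLine : MatSet 2 3 → Set₁
  IsLine 𝒳 = ∃[ B ] ∃[ W ] IsLineWith 𝒳 B W

  CondIWith : Mat 2 3 → MatSet 3 3 → Subset 6 → Set₁
  CondIWith Z 𝓡 N =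
    HasDim N 3 × HasDim (N ∩ S) 1
    × (∀ (L : Subset 6) →
         ((∃[ A ] (𝓡 A × L ≐ (E A ∩ H Z)))
           → (L ⊆ N × HasDim L 2 × (∀ v → L v → S v → v ≈ 0v)))
         × ((L ⊆ N × HasDim L 2 × (∀ v → L v → S v → v ≈ 0v))
           → ∃[ A ] (𝓡 A × L ≐ (E A ∩ H Z))))

  CondI : Mat 2 3 → MatSet 3 3 → Set₁
  CondI Z 𝓡 = ∃[ N ] CondIWith Z 𝓡 N

  CondII : Mat 2 3 → MatSet 3 3 → Set₁
  CondII Z 𝓡 = IsLine (ZR Z 𝓡)

  CondIIIWith : MatSet 3 3 → Mat 2 3 → MatSet 3 3 → Mat 3 3 → (Fin 2 → Mat 3 3) → Set
  CondIIIWith 𝒜 Z 𝓡 A₀ Ds =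
    𝒜 A₀ × MatsIndependent Ds × MatSpan Ds ⊆ₘ 𝒜
    × (∀ M → (𝓡 M → ∃[ D ] (MatSpan Ds D × M ≈ₘ (A₀ +ₘ D)))
           × (∃[ D ] (MatSpan Ds D × M ≈ₘ (A₀ +ₘ D)) → 𝓡 M))
    × (∀ D → MatSpan Ds D → ¬ (D ≈ₘ 0ₘ) → HasRank D 2)
    × (Span (λ z → ∃[ D ] (MatSpan Ds D × ¬ (D ≈ₘ 0ₘ) × LeftKer D z)) ≐ ⟨ Z ⟩)

  CondIII : MatSet 3 3 → Mat 2 3 → MatSet 3 3 → Set
  CondIII 𝒜 Z 𝓡 = ∃[ A₀ ] ∃[ Ds ] CondIIIWith 𝒜 Z 𝓡 A₀ Ds

  CommonRowGen : Mat 2 3 → (Fin 2 → Mat 3 3) → Vect 3 → Set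
  CommonRowGen Z Ds s =
    ¬ (s ≈ 0v) × (∀ D → MatSpan Ds D → ¬ ((Z ⊗ D) ≈ₘ 0ₘ) → ⟨ Z ⊗ D ⟩ ≐ ⟨ row s ⟩)

  Nmat : Mat 2 3 → Mat 3 3 → Vect 3 → Mat 3 6
  Nmat Z A₀ s = vcat (hcat {k = 3} Z (Z ⊗ A₀)) (hcat {k = 3} 0ₘ (row s))

  pad : Vect 3 → Mat 1 6
  pad s = hcat {k = 3} 0ₘ (row s)

-- Everything happens in the planes ⟨ (Z | M) ⟩ of F^6: E_A ∩ H is the plane of M = Z A, and A ∈ 𝒜 is
-- determined by Z A, since Z A = 0 would force rank A ≤ 1.  A 3-space N with N ∩ S = ⟨ (0 | s) ⟩
-- containing the plane of B is ⟨ (Z B ; 0 s) ⟩, and its planes meeting S trivially are exactly the planes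
-- of the matrices B + U with the rows of U in ⟨ s ⟩; this is (i) ⇔ (ii), the line being Z 𝓡 = B + 𝒰.
-- For (ii) ⇒ (iii), 𝒟 = 𝓡 − A₀ has Z 𝒟 = 𝒰, so rank D ≤ 1 + 1, and a left kernel vector of D outside
-- ⟨ Z ⟩ would even give rank D ≤ 1.  For (iii) ⇒ (ii), every Z D has rank one; if the rows of Z D₀ and
-- Z D₁ were independent, a left kernel vector of Z (D₀ + D₁) would yield a left kernel vector common to
-- all of 𝒟, confining all the left kernels to one line instead of letting them span ⟨ Z ⟩.

module Submission where

open import Defs
open import Data.Product using (_×_; ∃-syntax)
open import Data.Fin using (Fin)
open import Level using (0ℓ)

open import Data.Product using (∃; _,_; proj₁; proj₂)
open import Data.Empty using (⊥; ⊥-elim)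
open import Data.Nat as ℕ using (zero; suc; s≤s)
import Data.Nat.Properties as ℕP
open import Data.Fin as Fin using (zero; suc; punchIn)
import Data.Fin.Properties as FinP
open import Data.Fin.Patterns using (0F; 1F; 2F; 3F; 4F; 5F)
import Data.List.Relation.Unary.Any as Any
open import Relation.Nullary using (¬_; Dec; yes; no)
open import Relation.Nullary.Decidable using (¬?; decidable-stable; dec⇒maybe)
open import Relation.Binary.PropositionalEquality
open import Algebra.Bundles using (CommutativeRing; RawRing)
open import Algebra.Solver.Ring.AlmostCommutativeRing
  using (AlmostCommutativeRing; fromCommutativeRing; _-Raw-AlmostCommutative⟶_)
open import Data.Integer as ℤ using (ℤ; -[1+_]; sign; ∣_∣; _◃_; _⊖_)
import Data.Integer.Properties as ℤ
open import Data.Sign as Sign using (Sign)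
open import Data.Maybe as Maybe using (Maybe)
import Data.Vec.Functional as Vec
import Data.Vec.Functional.Properties as Vec

module LinearAlgebra (K : FiniteField) where
  open Over K public

  commutativeRing : CommutativeRing 0ℓ 0ℓ
  commutativeRing = record { isCommutativeRing = isCommRing }

  open CommutativeRing commutativeRing public
    using (+-assoc; +-comm; *-assoc; *-comm; +-identityˡ; +-identityʳ; *-identityˡ; *-identityʳ;
           distribˡ; distribʳ; -‿inverseˡ; -‿inverseʳ; zeroˡ; zeroʳ)
  open import Algebra.Properties.Ring (CommutativeRing.ring commutativeRing) public
    using (-‿involutive; -‿distribˡ-*; -‿distribʳ-*; -0#≈0#; -1*x≈-x; -‿anti-homo-+; -‿+-comm;
           +-inverseˡ-unique; x∙y⁻¹≈ε⇒x≈y; x≈y⇒x∙y⁻¹≈ε)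
  open import Algebra.Properties.CommutativeSemigroup (CommutativeRing.+-commutativeSemigroup commutativeRing)
    using () renaming (interchange to +-interchange)
  open import Algebra.Properties.CommutativeSemigroup (CommutativeRing.*-commutativeSemigroup commutativeRing)
    using () renaming (interchange to *-interchange)
  open import Algebra.Properties.Semiring.Mult (CommutativeRing.semiring commutativeRing)
    using (×-homo-+; ×1-homo-*) renaming (_×_ to _×ₙ_)

  -- Ring normalisation for F, through the canonical homomorphism ℤ → F: the solver needs a
  -- coefficient ring whose equality computes, which F itself does not provide.

  ℤ→F : ℤ → F
  ℤ→F (ℤ.+ n) = n ×ₙ 1#
  ℤ→F -[1+ n ] = - (suc n ×ₙ 1#)

  private
    signed : Sign → F
    signed Sign.+ = 1#
    signed Sign.- = - 1#

    signed-* : ∀ s t → signed (s Sign.* t) ≡ (signed s * signed t)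
    signed-* Sign.+ Sign.+ = sym (*-identityˡ 1#)
    signed-* Sign.+ Sign.- = sym (*-identityˡ _)
    signed-* Sign.- Sign.+ = sym (*-identityʳ _)
    signed-* Sign.- Sign.- = sym (trans (-1*x≈-x (- 1#)) (-‿involutive 1#))

    ℤ→F-◃ : ∀ s n → ℤ→F (s ◃ n) ≡ (signed s * (n ×ₙ 1#))
    ℤ→F-◃ s zero = sym (zeroʳ (signed s))
    ℤ→F-◃ Sign.+ (suc n) = sym (*-identityˡ _)
    ℤ→F-◃ Sign.- (suc n) = sym (-1*x≈-x _)

    ℤ→F-sign : ∀ i → ℤ→F i ≡ (signed (sign i) * (∣ i ∣ ×ₙ 1#))
    ℤ→F-sign i = trans (cong ℤ→F (sym (ℤ.◃-inverse i))) (ℤ→F-◃ (sign i) ∣ i ∣)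

    ℤ→F-* : ∀ i j → ℤ→F (i ℤ.* j) ≡ (ℤ→F i * ℤ→F j)
    ℤ→F-* i j = begin
        ℤ→F (i ℤ.* j)
      ≡⟨ ℤ→F-◃ (sign i Sign.* sign j) (∣ i ∣ ℕ.* ∣ j ∣) ⟩
        signed (sign i Sign.* sign j) * ((∣ i ∣ ℕ.* ∣ j ∣) ×ₙ 1#)
      ≡⟨ cong₂ _*_ (signed-* (sign i) (sign j)) (×1-homo-* ∣ i ∣ ∣ j ∣) ⟩
        (signed (sign i) * signed (sign j)) * ((∣ i ∣ ×ₙ 1#) * (∣ j ∣ ×ₙ 1#))
      ≡⟨ *-interchange (signed (sign i)) (signed (sign j)) _ _ ⟩
        (signed (sign i) * (∣ i ∣ ×ₙ 1#)) * (signed (sign j) * (∣ j ∣ ×ₙ 1#))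
      ≡⟨ sym (cong₂ _*_ (ℤ→F-sign i) (ℤ→F-sign j)) ⟩
        ℤ→F i * ℤ→F j ∎
      where open ≡-Reasoning

    ℤ→F-⊖ : ∀ m n → ℤ→F (m ⊖ n) ≡ ((m ×ₙ 1#) + (- (n ×ₙ 1#)))
    ℤ→F-⊖ zero zero = sym (trans (+-identityˡ _) -0#≈0#)
    ℤ→F-⊖ (suc m) zero = sym (trans (cong ((suc m ×ₙ 1#) +_) -0#≈0#) (+-identityʳ _))
    ℤ→F-⊖ zero (suc n) = sym (+-identityˡ _)
    ℤ→F-⊖ (suc m) (suc n) = begin
        ℤ→F (suc m ⊖ suc n)
      ≡⟨ cong ℤ→F (ℤ.[1+m]⊖[1+n]≡m⊖n m n) ⟩
        ℤ→F (m ⊖ n)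
      ≡⟨ ℤ→F-⊖ m n ⟩
        (m ×ₙ 1#) + (- (n ×ₙ 1#))
      ≡⟨ sym (cancel-1# (m ×ₙ 1#) (n ×ₙ 1#)) ⟩
        (suc m ×ₙ 1#) + (- (suc n ×ₙ 1#)) ∎
      where
      open ≡-Reasoning
      cancel-1# : ∀ a b → ((1# + a) + (- (1# + b))) ≡ (a + (- b))
      cancel-1# a b = begin
          (1# + a) + (- (1# + b))      ≡⟨ cong ((1# + a) +_) (trans (-‿anti-homo-+ 1# b) (+-comm (- b) (- 1#))) ⟩
          (1# + a) + ((- 1#) + (- b))  ≡⟨ +-interchange 1# a (- 1#) (- b) ⟩
          (1# + (- 1#)) + (a + (- b))  ≡⟨ cong (_+ (a + (- b))) (-‿inverseʳ 1#) ⟩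
          0# + (a + (- b))             ≡⟨ +-identityˡ _ ⟩
          a + (- b)                    ∎

    ℤ→F-+ : ∀ i j → ℤ→F (i ℤ.+ j) ≡ (ℤ→F i + ℤ→F j)
    ℤ→F-+ (ℤ.+ m) (ℤ.+ n) = ×-homo-+ 1# m n
    ℤ→F-+ (ℤ.+ m) -[1+ n ] = ℤ→F-⊖ m (suc n)
    ℤ→F-+ -[1+ m ] (ℤ.+ n) = trans (ℤ→F-⊖ n (suc m)) (+-comm _ _)
    ℤ→F-+ -[1+ m ] -[1+ n ] = begin
        - (suc (suc (m ℕ.+ n)) ×ₙ 1#)
      ≡⟨ cong -_ (trans (cong (λ k → k ×ₙ 1#) (sym (ℕP.+-suc (suc m) n))) (×-homo-+ 1# (suc m) (suc n))) ⟩
        - ((suc m ×ₙ 1#) + (suc n ×ₙ 1#))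
      ≡⟨ sym (-‿+-comm _ _) ⟩
        (- (suc m ×ₙ 1#)) + (- (suc n ×ₙ 1#)) ∎
      where open ≡-Reasoning

    ℤ→F-neg : ∀ i → ℤ→F (ℤ.- i) ≡ (- ℤ→F i)
    ℤ→F-neg -[1+ n ] = sym (-‿involutive _)
    ℤ→F-neg (ℤ.+ zero) = sym -0#≈0#
    ℤ→F-neg (ℤ.+ suc n) = refl

    ℤ-rawRing : RawRing 0ℓ 0ℓ
    ℤ-rawRing = record { Carrier = ℤ ; _≈_ = _≡_ ; _+_ = ℤ._+_ ; _*_ = ℤ._*_ ; -_ = ℤ.-_ ; 0# = ℤ.+ 0 ; 1# = ℤ.+ 1 }

    almostCommutativeRing : AlmostCommutativeRing 0ℓ 0ℓ
    almostCommutativeRing = fromCommutativeRing commutativeRing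

    ℤ→F-homomorphism : ℤ-rawRing -Raw-AlmostCommutative⟶ almostCommutativeRing
    ℤ→F-homomorphism = record
      { ⟦_⟧ = ℤ→F ; +-homo = ℤ→F-+ ; *-homo = ℤ→F-* ; -‿homo = ℤ→F-neg ; 0-homo = refl ; 1-homo = +-identityʳ 1# }

    ℤ→F-≟ : ∀ i j → Maybe (ℤ→F i ≡ ℤ→F j)
    ℤ→F-≟ i j = Maybe.map (cong ℤ→F) (dec⇒maybe (i ℤ.≟ j))

  open import Algebra.Solver.Ring ℤ-rawRing almostCommutativeRing ℤ→F-homomorphism ℤ→F-≟ public
    using (solve; _:=_; _:+_; _:*_; :-_; con)

  1≢0 : ¬ (1# ≡ 0#)
  1≢0 e = 0≢1 (sym e)

  inv : (a : F) → ¬ (a ≡ 0#) → F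
  inv a a≢0 = proj₁ (inverse a a≢0)

  inv-inverseʳ : ∀ a (a≢0 : ¬ (a ≡ 0#)) → a * inv a a≢0 ≡ 1#
  inv-inverseʳ a a≢0 = proj₂ (inverse a a≢0)

  inv-inverseˡ : ∀ a (a≢0 : ¬ (a ≡ 0#)) → inv a a≢0 * a ≡ 1#
  inv-inverseˡ a a≢0 = trans (*-comm _ a) (inv-inverseʳ a a≢0)

  *-cancelˡ-0 : ∀ a b → ¬ (a ≡ 0#) → a * b ≡ 0# → b ≡ 0#
  *-cancelˡ-0 a b a≢0 ab≡0 = begin
      b                          ≡⟨ sym (*-identityˡ b) ⟩
      1# * b                     ≡⟨ cong (_* b) (sym (inv-inverseˡ a a≢0)) ⟩
      (inv a a≢0 * a) * b        ≡⟨ *-assoc _ a b ⟩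
      inv a a≢0 * (a * b)        ≡⟨ cong (inv a a≢0 *_) ab≡0 ⟩
      inv a a≢0 * 0#             ≡⟨ zeroʳ _ ⟩
      0#                         ∎
    where open ≡-Reasoning

  solve-linear : ∀ a (a≢0 : ¬ (a ≡ 0#)) e s → (s + (a * e)) ≡ 0# → e ≡ ((- inv a a≢0) * s)
  solve-linear a a≢0 e s eq = begin
      e                          ≡⟨ sym (*-identityˡ e) ⟩
      1# * e                     ≡⟨ cong (_* e) (sym (inv-inverseˡ a a≢0)) ⟩
      (inv a a≢0 * a) * e        ≡⟨ *-assoc _ a e ⟩
      inv a a≢0 * (a * e)        ≡⟨ cong (inv a a≢0 *_) (+-inverseˡ-unique (a * e) s (trans (+-comm _ _) eq)) ⟩
      inv a a≢0 * (- s)          ≡⟨ sym (-‿distribʳ-* _ s) ⟩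
      - (inv a a≢0 * s)          ≡⟨ -‿distribˡ-* _ s ⟩
      (- inv a a≢0) * s          ∎
    where open ≡-Reasoning

  -- Finite sums

  ∑-cong : ∀ {n} {f g : Fin n → F} → (∀ i → f i ≡ g i) → ∑ f ≡ ∑ g
  ∑-cong {zero} e = refl
  ∑-cong {suc n} e = cong₂ _+_ (e zero) (∑-cong (λ i → e (suc i)))

  ∑-+ : ∀ {n} (f g : Fin n → F) → ∑ (λ i → f i + g i) ≡ (∑ f + ∑ g)
  ∑-+ {zero} f g = sym (+-identityʳ 0#)
  ∑-+ {suc n} f g = trans (cong ((f zero + g zero) +_) (∑-+ (λ i → f (suc i)) (λ i → g (suc i))))
    (solve 4 (λ a b c d → (a :+ b) :+ (c :+ d) := (a :+ c) :+ (b :+ d)) refl (f zero) (g zero) _ _)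

  ∑-*ˡ : ∀ {n} a (f : Fin n → F) → ∑ (λ i → a * f i) ≡ (a * ∑ f)
  ∑-*ˡ {zero} a f = sym (zeroʳ a)
  ∑-*ˡ {suc n} a f = trans (cong ((a * f zero) +_) (∑-*ˡ a (λ i → f (suc i)))) (sym (distribˡ a _ _))

  ∑-*ʳ : ∀ {n} a (f : Fin n → F) → ∑ (λ i → f i * a) ≡ (∑ f * a)
  ∑-*ʳ a f = trans (∑-cong (λ i → *-comm (f i) a)) (trans (∑-*ˡ a f) (*-comm a _))

  ∑-0 : ∀ {n} (f : Fin n → F) → (∀ i → f i ≡ 0#) → ∑ f ≡ 0#
  ∑-0 {zero} f e = refl
  ∑-0 {suc n} f e = trans (cong₂ _+_ (e zero) (∑-0 (λ i → f (suc i)) (λ i → e (suc i)))) (+-identityʳ 0#)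

  ∑-neg : ∀ {n} (f : Fin n → F) → ∑ (λ i → - f i) ≡ - ∑ f
  ∑-neg f = trans (∑-cong (λ i → sym (-1*x≈-x (f i)))) (trans (∑-*ˡ (- 1#) f) (-1*x≈-x _))

  ∑-comm : ∀ {m n} (f : Fin m → Fin n → F) → ∑ (λ i → ∑ (λ j → f i j)) ≡ ∑ (λ j → ∑ (λ i → f i j))
  ∑-comm {zero} {n} f = sym (∑-0 {n} (λ _ → 0#) (λ _ → refl))
  ∑-comm {suc m} f = trans (cong (∑ (f zero) +_) (∑-comm (λ i → f (suc i)))) (sym (∑-+ (f zero) _))

  ∑-punchIn : ∀ {n} (r : Fin (suc n)) (f : Fin (suc n) → F) → ∑ f ≡ (f r + ∑ (λ i → f (punchIn r i)))
  ∑-punchIn zero f = refl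
  ∑-punchIn {suc n} (suc r) f = trans (cong (f zero +_) (∑-punchIn r (λ i → f (suc i))))
    (solve 3 (λ a b c → a :+ (b :+ c) := b :+ (a :+ c)) refl (f zero) _ _)

  Iₘ-diag : ∀ {n} (k : Fin n) → Iₘ k k ≡ 1#
  Iₘ-diag k with k Fin.≟ k
  ... | yes _ = refl
  ... | no k≢k = ⊥-elim (k≢k refl)

  Iₘ-off : ∀ {n} (k i : Fin n) → ¬ (k ≡ i) → Iₘ k i ≡ 0#
  Iₘ-off k i k≢i with k Fin.≟ i
  ... | yes k≡i = ⊥-elim (k≢i k≡i)
  ... | no _ = refl

  Iₘ-sym : ∀ {n} (k i : Fin n) → Iₘ k i ≡ Iₘ i k
  Iₘ-sym k i with k Fin.≟ i
  ... | yes refl = sym (Iₘ-diag k)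
  ... | no k≢i = sym (Iₘ-off i k (λ e → k≢i (sym e)))

  ∑-Iₘˡ : ∀ {n} (k : Fin n) (f : Fin n → F) → ∑ (λ i → Iₘ k i * f i) ≡ f k
  ∑-Iₘˡ {suc n} k f = begin
      ∑ (λ i → Iₘ k i * f i)
    ≡⟨ ∑-punchIn k (λ i → Iₘ k i * f i) ⟩
      (Iₘ k k * f k) + ∑ (λ i → Iₘ k (punchIn k i) * f (punchIn k i))
    ≡⟨ cong₂ _+_ (cong (_* f k) (Iₘ-diag k)) (∑-0 _ (λ i → trans (cong (_* _) (off i)) (zeroˡ _))) ⟩
      (1# * f k) + 0#
    ≡⟨ trans (+-identityʳ _) (*-identityˡ _) ⟩
      f k ∎
    where
    open ≡-Reasoning
    off : ∀ i → Iₘ k (punchIn k i) ≡ 0#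
    off i = Iₘ-off k (punchIn k i) (λ e → FinP.punchInᵢ≢i k i (sym e))

  ∑-Iₘʳ : ∀ {n} (k : Fin n) (f : Fin n → F) → ∑ (λ i → f i * Iₘ i k) ≡ f k
  ∑-Iₘʳ k f = trans (∑-cong (λ i → trans (*-comm (f i) _) (cong (_* f i) (Iₘ-sym i k)))) (∑-Iₘˡ k f)

  -- Vectors and row spaces

  infixl 6 _+v_
  infixl 7 _*v_

  _+v_ : ∀ {n} → Vect n → Vect n → Vect n
  (u +v v) i = u i + v i

  _*v_ : ∀ {n} → F → Vect n → Vect n
  (a *v u) i = a * u i

  -v_ : ∀ {n} → Vect n → Vect n
  (-v u) i = - u i

  ≈-refl : ∀ {n} {u : Vect n} → u ≈ u
  ≈-refl i = refl

  ≈-sym : ∀ {n} {u v : Vect n} → u ≈ v → v ≈ u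
  ≈-sym e i = sym (e i)

  ≈-trans : ∀ {n} {u v w : Vect n} → u ≈ v → v ≈ w → u ≈ w
  ≈-trans e f i = trans (e i) (f i)

  ·-cong : ∀ {m n} {c d : Vect m} (M : Mat m n) → c ≈ d → (c · M) ≈ (d · M)
  ·-cong M e j = ∑-cong (λ i → cong (_* M i j) (e i))

  ·-congₘ : ∀ {m n} (c : Vect m) {M N : Mat m n} → M ≈ₘ N → (c · M) ≈ (c · N)
  ·-congₘ c e j = ∑-cong (λ i → cong (c i *_) (e i j))

  ·-+ : ∀ {m n} (c d : Vect m) (M : Mat m n) → ((c +v d) · M) ≈ ((c · M) +v (d · M))
  ·-+ c d M j = trans (∑-cong (λ i → distribʳ (M i j) (c i) (d i))) (∑-+ (λ i → c i * M i j) (λ i → d i * M i j))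

  ·-* : ∀ {m n} a (c : Vect m) (M : Mat m n) → ((a *v c) · M) ≈ (a *v (c · M))
  ·-* a c M j = trans (∑-cong (λ i → *-assoc a (c i) (M i j))) (∑-*ˡ a (λ i → c i * M i j))

  ·-neg : ∀ {m n} (c : Vect m) (M : Mat m n) → ((-v c) · M) ≈ (-v (c · M))
  ·-neg c M j = trans (∑-cong (λ i → sym (-‿distribˡ-* (c i) (M i j)))) (∑-neg (λ i → c i * M i j))

  ·-zeroˡ : ∀ {m n} (M : Mat m n) → (0v · M) ≈ 0v
  ·-zeroˡ M j = ∑-0 _ (λ i → zeroˡ (M i j))

  ·-zeroʳ : ∀ {m n} (c : Vect m) → (c · 0ₘ {m} {n}) ≈ 0v
  ·-zeroʳ c j = ∑-0 _ (λ i → zeroʳ (c i))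

  ·-Iₘˡ : ∀ {m n} (k : Fin m) (M : Mat m n) → (Iₘ k · M) ≈ M k
  ·-Iₘˡ k M j = ∑-Iₘˡ k (λ i → M i j)

  ·-Iₘʳ : ∀ {n} (v : Vect n) → (v · Iₘ) ≈ v
  ·-Iₘʳ v j = ∑-Iₘʳ j v

  ·-⊗ : ∀ {m k n} (c : Vect m) (M : Mat m k) (N : Mat k n) → (c · (M ⊗ N)) ≈ ((c · M) · N)
  ·-⊗ c M N j = begin
      ∑ (λ i → c i * ∑ (λ t → M i t * N t j))
    ≡⟨ ∑-cong (λ i → sym (∑-*ˡ (c i) (λ t → M i t * N t j))) ⟩
      ∑ (λ i → ∑ (λ t → c i * (M i t * N t j)))
    ≡⟨ ∑-comm (λ i t → c i * (M i t * N t j)) ⟩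
      ∑ (λ t → ∑ (λ i → c i * (M i t * N t j)))
    ≡⟨ ∑-cong (λ t → trans (∑-cong (λ i → sym (*-assoc (c i) (M i t) (N t j)))) (∑-*ʳ (N t j) (λ i → c i * M i t))) ⟩
      ∑ (λ t → ∑ (λ i → c i * M i t) * N t j) ∎
    where open ≡-Reasoning

  ·-+ₘ : ∀ {m n} (c : Vect m) (A B : Mat m n) → (c · (A +ₘ B)) ≈ ((c · A) +v (c · B))
  ·-+ₘ c A B j = trans (∑-cong (λ i → distribˡ (c i) (A i j) (B i j))) (∑-+ (λ i → c i * A i j) (λ i → c i * B i j))

  ·-•ₘ : ∀ {m n} (c : Vect m) a (A : Mat m n) → (c · (a •ₘ A)) ≈ (a *v (c · A))
  ·-•ₘ c a A j = trans (∑-cong (λ i → solve 3 (λ x y z → x :* (y :* z) := y :* (x :* z)) refl (c i) a (A i j)))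
                       (∑-*ˡ a (λ i → c i * A i j))

  ·-lincombₘ : ∀ {k m n} (c : Vect m) (d : Vect k) (Ds : Fin k → Mat m n) →
               (c · lincombₘ d Ds) ≈ (λ j → ∑ (λ t → d t * (c · Ds t) j))
  ·-lincombₘ c d Ds j = begin
      ∑ (λ i → c i * ∑ (λ t → d t * Ds t i j))
    ≡⟨ ∑-cong (λ i → sym (∑-*ˡ (c i) (λ t → d t * Ds t i j))) ⟩
      ∑ (λ i → ∑ (λ t → c i * (d t * Ds t i j)))
    ≡⟨ ∑-comm (λ i t → c i * (d t * Ds t i j)) ⟩
      ∑ (λ t → ∑ (λ i → c i * (d t * Ds t i j)))
    ≡⟨ ∑-cong (λ t → trans (∑-cong (λ i → solve 3 (λ x y z → x :* (y :* z) := y :* (x :* z)) refl (c i) (d t) (Ds t i j)))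
                           (∑-*ˡ (d t) (λ i → c i * Ds t i j))) ⟩
      ∑ (λ t → d t * ∑ (λ i → c i * Ds t i j)) ∎
    where open ≡-Reasoning

  ⟨⟩-resp : ∀ {m n} {M : Mat m n} {u v} → u ≈ v → ⟨ M ⟩ u → ⟨ M ⟩ v
  ⟨⟩-resp e (c , p) = c , ≈-trans (≈-sym e) p

  ⟨⟩-congₘ : ∀ {m n} {M M′ : Mat m n} → M ≈ₘ M′ → ⟨ M ⟩ ≐ ⟨ M′ ⟩
  ⟨⟩-congₘ e v = (λ (c , q) → c , ≈-trans q (·-congₘ c e))
               , (λ (c , q) → c , ≈-trans q (·-congₘ c (λ i j → sym (e i j))))

  ⟨⟩-0 : ∀ {m n} (M : Mat m n) → ⟨ M ⟩ 0v
  ⟨⟩-0 M = 0v , ≈-sym (·-zeroˡ M)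

  ⟨⟩-+ : ∀ {m n} {M : Mat m n} {u v} → ⟨ M ⟩ u → ⟨ M ⟩ v → ⟨ M ⟩ (u +v v)
  ⟨⟩-+ {M = M} (c , p) (d , q) = (c +v d) , λ j → trans (cong₂ _+_ (p j) (q j)) (sym (·-+ c d M j))

  ⟨⟩-* : ∀ {m n} {M : Mat m n} a {u} → ⟨ M ⟩ u → ⟨ M ⟩ (a *v u)
  ⟨⟩-* {M = M} a (c , p) = (a *v c) , λ j → trans (cong (a *_) (p j)) (sym (·-* a c M j))

  ⟨⟩-neg : ∀ {m n} {M : Mat m n} {u} → ⟨ M ⟩ u → ⟨ M ⟩ (-v u)
  ⟨⟩-neg {M = M} (c , p) = (-v c) , λ j → trans (cong -_ (p j)) (sym (·-neg c M j))

  ⟨⟩-row : ∀ {m n} (M : Mat m n) k → ⟨ M ⟩ (M k)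
  ⟨⟩-row M k = Iₘ k , ≈-sym (·-Iₘˡ k M)

  ⟨⟩-· : ∀ {m n} (M : Mat m n) (c : Vect m) → ⟨ M ⟩ (c · M)
  ⟨⟩-· M c = c , ≈-refl

  ⟨⟩-mono : ∀ {m k n} {M : Mat m n} {N : Mat k n} → (∀ i → ⟨ N ⟩ (M i)) → ⟨ M ⟩ ⊆ ⟨ N ⟩
  ⟨⟩-mono {M = M} {N} rows v (c , p) =
    (c · C) , ≈-trans p (≈-trans (·-congₘ c {M} {C ⊗ N} (λ i → proj₂ (rows i))) (·-⊗ c C N))
    where
    C = λ i → proj₁ (rows i)

  ⟨Iₘ⟩ : ∀ {n} (v : Vect n) → ⟨ Iₘ ⟩ v
  ⟨Iₘ⟩ v = v , ≈-sym (·-Iₘʳ v)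

  ≐-sym : ∀ {n} {P Q : Subset n} → P ≐ Q → Q ≐ P
  ≐-sym e v = proj₂ (e v) , proj₁ (e v)

  ≐-trans : ∀ {n} {P Q R : Subset n} → P ≐ Q → Q ≐ R → P ≐ R
  ≐-trans e f v = (λ p → proj₁ (f v) (proj₁ (e v) p)) , (λ r → proj₂ (e v) (proj₂ (f v) r))

  module _ {m n} {P : Subset n} {M : Mat m n} (P≐⟨M⟩ : P ≐ ⟨ M ⟩) where

    ≐⟨⟩-resp : ∀ {u v} → u ≈ v → P u → P v
    ≐⟨⟩-resp e pu = proj₂ (P≐⟨M⟩ _) (⟨⟩-resp e (proj₁ (P≐⟨M⟩ _) pu))

    ≐⟨⟩-+ : ∀ {u v} → P u → P v → P (u +v v)
    ≐⟨⟩-+ pu pv = proj₂ (P≐⟨M⟩ _) (⟨⟩-+ (proj₁ (P≐⟨M⟩ _) pu) (proj₁ (P≐⟨M⟩ _) pv))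

    ≐⟨⟩-neg : ∀ {u} → P u → P (-v u)
    ≐⟨⟩-neg pu = proj₂ (P≐⟨M⟩ _) (⟨⟩-neg (proj₁ (P≐⟨M⟩ _) pu))

  Nonzero : ∀ {n} → Vect n → Set
  Nonzero v = ∃[ i ] (¬ (v i ≡ 0#))

  Nonzero⇒≉0 : ∀ {n} {v : Vect n} → Nonzero v → ¬ (v ≈ 0v)
  Nonzero⇒≉0 (i , vᵢ≢0) v≈0 = vᵢ≢0 (v≈0 i)

  ≉0⇒Nonzero : ∀ {n} {v : Vect n} → ¬ (v ≈ 0v) → Nonzero v
  ≉0⇒Nonzero {n} {v} v≉0 = FinP.¬∀⟶∃¬ n (λ i → v i ≡ 0#) (λ i → v i ≟ 0#) v≉0

  *v-cancelʳ-0 : ∀ {n} {w : Vect n} a → Nonzero w → (a *v w) ≈ 0v → a ≡ 0#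
  *v-cancelʳ-0 {w = w} a (i , wᵢ≢0) e = *-cancelˡ-0 (w i) a wᵢ≢0 (trans (*-comm (w i) a) (e i))

  _≟ₘ_ : ∀ {m n} (M N : Mat m n) → Dec (M ≈ₘ N)
  M ≟ₘ N = FinP.all? (λ i → FinP.all? (λ j → M i j ≟ N i j))

  ∃? : ∀ m (P : Vect m → Set) → (∀ {c d} → c ≈ d → P c → P d) → (∀ c → Dec (P c)) → Dec (∃ P)
  ∃? zero P resp P? with P? (λ ())
  ... | yes p = yes (_ , p)
  ... | no ¬p = no (λ (c , pc) → ¬p (resp (λ ()) pc))
  ∃? (suc m) P resp P? with Any.any? (λ x → ∃? m (λ c → P (x Vec.∷ c)) (λ e → resp (λ { zero → refl ; (suc i) → e i })) (λ c → P? _)) elements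
  ... | yes found with Any.satisfied found
  ... | x , (c , p) = yes (x Vec.∷ c , p)
  ∃? (suc m) P resp P? | no none =
    no λ (c , pc) → none (Any.map (λ { refl → Vec.tail c , resp (λ { zero → refl ; (suc i) → refl }) pc }) (complete (c zero)))

  ⟨_⟩? : ∀ {m n} (M : Mat m n) v → Dec (⟨ M ⟩ v)
  ⟨_⟩? {m} M v = ∃? m (λ c → v ≈ (c · M)) (λ e p → ≈-trans p (·-cong M e)) (λ c → FinP.all? (λ i → v i ≟ (c · M) i))

  -- Dimension

  Iₘ-independent : ∀ {n} → RowsIndependent (Iₘ {n})
  Iₘ-independent c e i = trans (sym (·-Iₘʳ c i)) (e i)

  -- Gaussian elimination: column zero of the rows other than the pivot row r is cleared with row r
  eliminate : ∀ {m k} (C : Mat (suc m) (suc k)) r → ¬ (C r zero ≡ 0#) → Mat m k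
  eliminate C r a≢0 i j = C (punchIn r i) (suc j) + (- ((C (punchIn r i) zero * inv (C r zero) a≢0) * C r (suc j)))

  eliminate-dependent : ∀ {m k} (C : Mat (suc m) (suc k)) r (a≢0 : ¬ (C r zero ≡ 0#)) →
                        ∃[ c′ ] (Nonzero c′ × (c′ · eliminate C r a≢0) ≈ 0v) → ∃[ c ] (Nonzero c × (c · C) ≈ 0v)
  eliminate-dependent C r a≢0 (c′ , (r′ , c′ᵣ′≢0) , c′·C′≈0) = c , (punchIn r r′ , c≢0) , c·C≈0
    where
    a = C r zero
    a⁻¹ = inv a a≢0
    T = ∑ (λ i → c′ i * C (punchIn r i) zero)
    β = - (T * a⁻¹)
    c = Vec.insertAt c′ r β
    c≢0 : ¬ (c (punchIn r r′) ≡ 0#)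
    c≢0 e = c′ᵣ′≢0 (trans (sym (Vec.insertAt-punchIn c′ r β r′)) e)
    split : ∀ j → (c · C) j ≡ ((β * C r j) + ∑ (λ i → c′ i * C (punchIn r i) j))
    split j = trans (∑-punchIn r (λ x → c x * C x j))
      (cong₂ _+_ (cong (_* C r j) (Vec.insertAt-lookup c′ r β))
                 (∑-cong (λ i → cong (_* C (punchIn r i) j) (Vec.insertAt-punchIn c′ r β i))))
    c·C≈0 : (c · C) ≈ 0v
    c·C≈0 zero = trans (split zero) (begin
        (β * a) + T
      ≡⟨ cong (_+ T) (trans (sym (-‿distribˡ-* (T * a⁻¹) a)) (cong -_ (trans (*-assoc T a⁻¹ a) (trans (cong (T *_) (inv-inverseˡ a a≢0)) (*-identityʳ T))))) ⟩
        (- T) + T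
      ≡⟨ -‿inverseˡ T ⟩
        0# ∎)
      where open ≡-Reasoning
    c·C≈0 (suc j) = trans (split (suc j)) (begin
        (β * C r (suc j)) + U
      ≡⟨ solve 4 (λ x y z u → (:- (x :* y)) :* z :+ u := u :+ (:- (x :* (y :* z)))) refl T a⁻¹ (C r (suc j)) U ⟩
        U + (- (T * (a⁻¹ * C r (suc j))))
      ≡⟨ cong (λ x → U + (- x)) (sym (∑-*ʳ (a⁻¹ * C r (suc j)) (λ i → c′ i * C (punchIn r i) zero))) ⟩
        U + (- ∑ (λ i → (c′ i * C (punchIn r i) zero) * (a⁻¹ * C r (suc j))))
      ≡⟨ cong (U +_) (sym (∑-neg (λ i → (c′ i * C (punchIn r i) zero) * (a⁻¹ * C r (suc j))))) ⟩
        U + ∑ (λ i → - ((c′ i * C (punchIn r i) zero) * (a⁻¹ * C r (suc j))))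
      ≡⟨ sym (∑-+ (λ i → c′ i * C (punchIn r i) (suc j)) _) ⟩
        ∑ (λ i → (c′ i * C (punchIn r i) (suc j)) + (- ((c′ i * C (punchIn r i) zero) * (a⁻¹ * C r (suc j)))))
      ≡⟨ ∑-cong (λ i → solve 5 (λ c x y z w → c :* x :+ (:- ((c :* y) :* (z :* w))) := c :* (x :+ (:- ((y :* z) :* w))))
                               refl (c′ i) (C (punchIn r i) (suc j)) (C (punchIn r i) zero) a⁻¹ (C r (suc j))) ⟩
        ∑ (λ i → c′ i * eliminate C r a≢0 i j)
      ≡⟨ c′·C′≈0 j ⟩
        0# ∎)
      where
      open ≡-Reasoning
      U = ∑ (λ i → c′ i * C (punchIn r i) (suc j))

  rows>cols⇒dependent : ∀ {k m} → k ℕ.< m → (C : Mat m k) → ∃[ c ] (Nonzero c × (c · C) ≈ 0v)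
  rows>cols⇒dependent {zero} {suc m} _ C = Iₘ zero , (zero , λ e → 1≢0 (trans (sym (Iₘ-diag {suc m} zero)) e)) , λ ()
  rows>cols⇒dependent {suc k} {suc m} (s≤s k<m) C with FinP.any? (λ r → ¬? (C r zero ≟ 0#))
  ... | yes (r , a≢0) = eliminate-dependent C r a≢0 (rows>cols⇒dependent k<m (eliminate C r a≢0))
  ... | no no-pivot = c , c≢0 , λ { zero → ∑-0 _ (λ i → trans (cong (c i *_) (column₀≡0 i)) (zeroʳ _)) ; (suc j) → c·C≈0 j }
    where
    column₀≡0 : ∀ r → C r zero ≡ 0#
    column₀≡0 r with C r zero ≟ 0#
    ... | yes e = e
    ... | no ne = ⊥-elim (no-pivot (r , ne))
    IH = rows>cols⇒dependent (ℕP.m<n⇒m<1+n k<m) (λ i j → C i (suc j))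
    c = proj₁ IH
    c≢0 = proj₁ (proj₂ IH)
    c·C≈0 = proj₂ (proj₂ IH)

  ⊆⟨⟩⇒dependent : ∀ {m k n} (R : Mat m n) (B : Mat k n) → k ℕ.< m → (∀ i → ⟨ B ⟩ (R i)) →
                  ∃[ d ] (Nonzero d × (d · R) ≈ 0v)
  ⊆⟨⟩⇒dependent R B k<m rows = d , d≢0 , λ j →
      trans (·-congₘ d {R} {C ⊗ B} (λ i → proj₂ (rows i)) j) (trans (·-⊗ d C B j) (trans (·-cong B d·C≈0 j) (·-zeroˡ B j)))
    where
    C = λ i → proj₁ (rows i)
    dependence = rows>cols⇒dependent k<m C
    d = proj₁ dependence
    d≢0 = proj₁ (proj₂ dependence)
    d·C≈0 = proj₂ (proj₂ dependence)

  independent-⊆⟨⟩⇒≤ : ∀ {m k n} (R : Mat m n) (B : Mat k n) → RowsIndependent R → (∀ i → ⟨ B ⟩ (R i)) → m ℕ.≤ k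
  independent-⊆⟨⟩⇒≤ {m} {k} R B R-ind rows with m ℕ.≤? k
  ... | yes m≤k = m≤k
  ... | no m≰k with ⊆⟨⟩⇒dependent R B (ℕP.≰⇒> m≰k) rows
  ... | d , d≢0 , d·R≈0 = ⊥-elim (Nonzero⇒≉0 d≢0 (R-ind d d·R≈0))

  independent-⊆⟨⟩⇒spans : ∀ {k k′ n} (R : Mat k n) (B : Mat k′ n) → k′ ℕ.≤ k → RowsIndependent R →
                           (∀ i → ⟨ B ⟩ (R i)) → ⟨ B ⟩ ⊆ ⟨ R ⟩
  independent-⊆⟨⟩⇒spans R B k′≤k R-ind rows v v∈B
    with ⊆⟨⟩⇒dependent (v Vec.∷ R) B (s≤s k′≤k) (λ { zero → v∈B ; (suc i) → rows i })
  ... | d , d≢0 , d·vR≈0 with d zero ≟ 0#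
  ... | yes d₀≡0 = ⊥-elim (Nonzero⇒≉0 d≢0 λ { zero → d₀≡0 ; (suc i) → R-ind (Vec.tail d) tail≈0 i })
    where
    tail≈0 : (Vec.tail d · R) ≈ 0v
    tail≈0 j = trans (sym (trans (cong (λ x → (x * v j) + (Vec.tail d · R) j) d₀≡0)
                                 (trans (cong (_+ (Vec.tail d · R) j) (zeroˡ (v j))) (+-identityˡ _))))
                     (d·vR≈0 j)
  ... | no d₀≢0 = ((- inv (d zero) d₀≢0) *v Vec.tail d) , λ j →
      trans (solve-linear (d zero) d₀≢0 (v j) _ (trans (+-comm _ _) (d·vR≈0 j))) (sym (·-* _ (Vec.tail d) R j))

  independent-square-spans : ∀ {n} (G : Mat n n) → RowsIndependent G → ∀ v → ⟨ G ⟩ v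
  independent-square-spans G G-ind v = independent-⊆⟨⟩⇒spans G Iₘ ℕP.≤-refl G-ind (λ i → ⟨Iₘ⟩ (G i)) v (⟨Iₘ⟩ v)

  ·-injective : ∀ {m n} (M : Mat m n) → RowsIndependent M → ∀ c d → (c · M) ≈ (d · M) → c ≈ d
  ·-injective M M-ind c d e i = x∙y⁻¹≈ε⇒x≈y (c i) (d i) (M-ind (c +v (-v d)) c-d·M≈0 i)
    where
    c-d·M≈0 : ((c +v (-v d)) · M) ≈ 0v
    c-d·M≈0 j = trans (·-+ c (-v d) M j) (trans (cong ((c · M) j +_) (·-neg d M j)) (x≈y⇒x∙y⁻¹≈ε (e j)))

  HasDim-cong : ∀ {k n} {P Q : Subset n} → P ≐ Q → HasDim P k → HasDim Q k
  HasDim-cong e (B , B-ind , P≐B) = B , B-ind , ≐-trans (≐-sym e) P≐B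

  HasDim-⟨⟩ : ∀ {k n} (R : Mat k n) → RowsIndependent R → HasDim ⟨ R ⟩ k
  HasDim-⟨⟩ R R-ind = R , R-ind , λ v → (λ x → x) , (λ x → x)

  HasDim-basis : ∀ {k n} {P : Subset n} → HasDim P k → (R : Mat k n) → RowsIndependent R → (∀ i → P (R i)) → P ≐ ⟨ R ⟩
  HasDim-basis (B , B-ind , P≐B) R R-ind rows v =
      (λ pv → independent-⊆⟨⟩⇒spans R B ℕP.≤-refl R-ind rows∈B v (proj₁ (P≐B v) pv))
    , (λ rv → proj₂ (P≐B v) (⟨⟩-mono rows∈B v rv))
    where
    rows∈B = λ i → proj₁ (P≐B _) (rows i)

  extend-to-basis : ∀ {k} (X : Mat k (suc k)) → RowsIndependent X →
                    ∃[ y ] (∀ c → ∃[ a ] ∃[ t ] (c ≈ ((a · X) +v (t *v y))))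
  extend-to-basis {k} X X-ind with FinP.any? (λ j → ¬? (⟨ X ⟩? (Iₘ j)))
  ... | no all-in = ⊥-elim (ℕP.1+n≰n (independent-⊆⟨⟩⇒≤ Iₘ X Iₘ-independent Iₘ⊆X))
    where
    Iₘ⊆X : ∀ j → ⟨ X ⟩ (Iₘ j)
    Iₘ⊆X j with ⟨ X ⟩? (Iₘ j)
    ... | yes p = p
    ... | no ¬p = ⊥-elim (all-in (j , ¬p))
  ... | yes (j , y∉X) = y , decompose
    where
    y = Iₘ j
    Y = y Vec.∷ X
    Y-ind : RowsIndependent Y
    Y-ind d e with d zero ≟ 0#
    ... | yes d₀≡0 = λ { zero → d₀≡0 ; (suc i) → X-ind (Vec.tail d) tail≈0 i }
      where
      tail≈0 : (Vec.tail d · X) ≈ 0v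
      tail≈0 l = trans (sym (trans (cong (λ x → (x * y l) + (Vec.tail d · X) l) d₀≡0)
                                   (trans (cong (_+ (Vec.tail d · X) l) (zeroˡ (y l))) (+-identityˡ _))))
                       (e l)
    ... | no d₀≢0 = ⊥-elim (y∉X (((- inv (d zero) d₀≢0) *v Vec.tail d) , λ l →
          trans (solve-linear (d zero) d₀≢0 (y l) _ (trans (+-comm _ _) (e l))) (sym (·-* _ (Vec.tail d) X l))))
    decompose : ∀ c → ∃[ a ] ∃[ t ] (c ≈ ((a · X) +v (t *v y)))
    decompose c = Vec.tail d , d zero , λ l → trans (c≈d·Y l) (+-comm (d zero * y l) ((Vec.tail d · X) l))
      where
      d = proj₁ (independent-square-spans Y Y-ind c)
      c≈d·Y = proj₂ (independent-square-spans Y Y-ind c)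

  -- One-dimensional subspaces

  ⟨row⟩⇒multiple : ∀ {n} {w v : Vect n} → ⟨ row w ⟩ v → ∃[ μ ] (v ≈ (μ *v w))
  ⟨row⟩⇒multiple (c , v≈) = c 0F , λ j → trans (v≈ j) (+-identityʳ _)

  ⟨row⟩-multiple : ∀ {n} (w : Vect n) μ → ⟨ row w ⟩ (μ *v w)
  ⟨row⟩-multiple w μ = (λ _ → μ) , λ j → sym (+-identityʳ _)

  row-independent : ∀ {n} {w : Vect n} → Nonzero w → RowsIndependent (row w)
  row-independent {w = w} w≢0 c e 0F = *v-cancelʳ-0 (c 0F) w≢0 (λ j → trans (sym (+-identityʳ _)) (e j))

  HasDim-1⇒line : ∀ {n} {W : Subset n} → HasDim W 1 → ∃[ w ] (Nonzero w × W ≐ ⟨ row w ⟩)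
  HasDim-1⇒line (b , b-ind , W≐b) = b 0F , b₀≢0 , ≐-trans W≐b (⟨⟩-congₘ {M = b} {M′ = row (b 0F)} λ { 0F j → refl })
    where
    b₀≢0 : Nonzero (b 0F)
    b₀≢0 = ≉0⇒Nonzero λ b₀≈0 → 1≢0 (b-ind (λ _ → 1#) (λ j → trans (+-identityʳ _) (trans (cong (1# *_) (b₀≈0 j)) (zeroʳ 1#))) 0F)

  pair : ∀ {n} → Vect n → Vect n → Mat 2 n
  pair a b 0F = a
  pair a b 1F = b

  pair-independent : ∀ {n} (a b : Vect n) → Nonzero a → ¬ (⟨ row a ⟩ b) → RowsIndependent (pair a b)
  pair-independent a b a≢0 b∉a c e with c 1F ≟ 0#
  ... | yes c₁≡0 = λ { 0F → c₀≡0 ; 1F → c₁≡0 }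
    where
    c₀≡0 : c 0F ≡ 0#
    c₀≡0 = *v-cancelʳ-0 (c 0F) a≢0 λ j → trans (sym (trans (cong (λ x → (c 0F * a j) + ((x * b j) + 0#)) c₁≡0)
                                                  (solve 2 (λ x y → x :+ (con (ℤ.+ 0) :* y :+ con (ℤ.+ 0)) := x) refl _ (b j))))
                                           (e j)
  ... | no c₁≢0 = ⊥-elim (b∉a ((λ _ → (- inv (c 1F) c₁≢0) * c 0F) , λ j →
      trans (solve-linear (c 1F) c₁≢0 (b j) (c 0F * a j) (trans (cong ((c 0F * a j) +_) (sym (+-identityʳ _))) (e j)))
            (trans (sym (*-assoc _ _ _)) (sym (+-identityʳ _)))))

  -- Rank

  module _ {k} (Z : Mat k (suc k)) (Z-ind : RowsIndependent Z) where

    complement : Vect (suc k)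
    complement = proj₁ (extend-to-basis Z Z-ind)

    ·-split : ∀ {n} (A : Mat (suc k) n) c → ∃[ a ] ∃[ t ] ((c · A) ≈ ((a · (Z ⊗ A)) +v (t *v (complement · A))))
    ·-split A c = a , t , λ j → trans (·-cong A c≈ j) (trans (·-+ (a · Z) (t *v complement) A j)
                                                             (cong₂ _+_ (sym (·-⊗ a Z A j)) (·-* t complement A j)))
      where
      a = proj₁ (proj₂ (extend-to-basis Z Z-ind) c)
      t = proj₁ (proj₂ (proj₂ (extend-to-basis Z Z-ind) c))
      c≈ = proj₂ (proj₂ (proj₂ (extend-to-basis Z Z-ind) c))

    -- the row space of A is spanned by the rows of Z A together with complement · A
    HasRank-≤-suc : ∀ {n r d} (A : Mat (suc k) n) (W : Mat r n) → (∀ i → ⟨ W ⟩ ((Z ⊗ A) i)) → HasRank A d → d ℕ.≤ suc r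
    HasRank-≤-suc A W ZA⊆W (B , B-ind , A≐B) = independent-⊆⟨⟩⇒≤ B yA∷W B-ind B⊆
      where
      yA∷W = (complement · A) Vec.∷ W
      c·A∈ : ∀ c → ⟨ yA∷W ⟩ (c · A)
      c·A∈ c = ⟨⟩-resp {M = yA∷W} (≈-sym (proj₂ (proj₂ split)))
          (⟨⟩-+ {M = yA∷W} (⟨⟩-mono {M = W} {N = yA∷W} (λ i → ⟨⟩-row yA∷W (suc i)) _ (⟨⟩-mono ZA⊆W _ (⟨⟩-· (Z ⊗ A) (proj₁ split))))
                           (⟨⟩-* {M = yA∷W} (proj₁ (proj₂ split)) (⟨⟩-row yA∷W zero)))
        where
        split = ·-split A c
      B⊆ : ∀ i → ⟨ yA∷W ⟩ (B i)
      B⊆ i = ⟨⟩-resp {M = yA∷W} (≈-sym (proj₂ Bᵢ∈A)) (c·A∈ (proj₁ Bᵢ∈A))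
        where
        Bᵢ∈A = proj₂ (A≐B (B i)) (⟨⟩-row B i)

    HasRank-≤-1 : ∀ {n d} (A : Mat (suc k) n) → (Z ⊗ A) ≈ₘ 0ₘ → HasRank A d → d ℕ.≤ 1
    HasRank-≤-1 A ZA≈0 = HasRank-≤-suc A none (λ i → ⟨⟩-resp {M = none} (λ j → sym (ZA≈0 i j)) (⟨⟩-0 none))
      where
      none : Mat 0 _
      none ()

    -- a left kernel vector of A outside ⟨ Z ⟩ would put complement · A, hence all of ⟨ A ⟩, inside ⟨ W ⟩
    LeftKer⊆⟨⟩ : ∀ {n r d} (A : Mat (suc k) n) (W : Mat r n) → (∀ i → ⟨ W ⟩ ((Z ⊗ A) i)) → HasRank A d → r ℕ.< d →
                 ∀ z → LeftKer A z → ⟨ Z ⟩ z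
    LeftKer⊆⟨⟩ A W ZA⊆W (B , B-ind , A≐B) r<d z z·A≈0 = by-cases (t ≟ 0#)
      where
      a = proj₁ (proj₂ (extend-to-basis Z Z-ind) z)
      t = proj₁ (proj₂ (proj₂ (extend-to-basis Z Z-ind) z))
      z≈ = proj₂ (proj₂ (proj₂ (extend-to-basis Z Z-ind) z))
      by-cases : Dec (t ≡ 0#) → ⟨ Z ⟩ z
      by-cases (yes t≡0) = a , λ j → trans (z≈ j) (trans (cong ((a · Z) j +_) (trans (cong (_* complement j) t≡0) (zeroˡ _))) (+-identityʳ _))
      by-cases (no t≢0) = ⊥-elim (ℕP.<⇒≱ r<d (independent-⊆⟨⟩⇒≤ B W B-ind B⊆W))
        where
        a·ZA∈W : ⟨ W ⟩ (a · (Z ⊗ A))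
        a·ZA∈W = ⟨⟩-mono ZA⊆W _ (⟨⟩-· (Z ⊗ A) a)
        μ = proj₁ a·ZA∈W
        yA≈ : (complement · A) ≈ ((- inv t t≢0) *v (μ · W))
        yA≈ j = solve-linear t t≢0 ((complement · A) j) _
          (trans (cong (_+ (t * (complement · A) j)) (sym (proj₂ a·ZA∈W j)))
                 (trans (cong₂ _+_ (·-⊗ a Z A j) (sym (·-* t complement A j)))
                        (trans (sym (·-+ (a · Z) (t *v complement) A j)) (trans (sym (·-cong A z≈ j)) (z·A≈0 j)))))
        c·A∈W : ∀ c → ⟨ W ⟩ (c · A)
        c·A∈W c = ⟨⟩-resp {M = W} (≈-sym (proj₂ (proj₂ split)))
            (⟨⟩-+ {M = W} (⟨⟩-mono ZA⊆W _ (⟨⟩-· (Z ⊗ A) (proj₁ split)))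
                          (⟨⟩-* {M = W} (proj₁ (proj₂ split)) (⟨⟩-resp {M = W} (≈-sym yA≈) (⟨⟩-* {M = W} _ (⟨⟩-· W μ)))))
          where
          split = ·-split A c
        B⊆W : ∀ i → ⟨ W ⟩ (B i)
        B⊆W i = ⟨⟩-resp {M = W} (≈-sym (proj₂ Bᵢ∈A)) (c·A∈W (proj₁ Bᵢ∈A))
          where
          Bᵢ∈A = proj₂ (A≐B (B i)) (⟨⟩-row B i)

  -- R′ is R with a row dropped at which c is nonzero
  complement-of-line : ∀ {k n} (R : Mat (suc k) n) → RowsIndependent R → ∀ c → Nonzero c →
                       ∃[ R′ ] (RowsIndependent {k} R′ × ⟨ R′ ⟩ ⊆ ⟨ R ⟩ × (∀ μ v → ⟨ R′ ⟩ v → v ≈ (μ *v (c · R)) → μ ≡ 0#))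
  complement-of-line R R-ind c (l , cₗ≢0) = R′ , R′-ind , ⟨⟩-mono {N = R} (λ i → ⟨⟩-row R (punchIn l i)) , meets-trivially
    where
    R′ = λ i → R (punchIn l i)
    lift : Vect _ → Vect _
    lift d = Vec.insertAt d l 0#
    ·-lift : ∀ d → (lift d · R) ≈ (d · R′)
    ·-lift d j = trans (∑-punchIn l (λ x → lift d x * R x j))
      (trans (cong₂ _+_ (trans (cong (_* R l j) (Vec.insertAt-lookup d l 0#)) (zeroˡ _))
                        (∑-cong (λ i → cong (_* R (punchIn l i) j) (Vec.insertAt-punchIn d l 0# i))))
             (+-identityˡ _))
    R′-ind : RowsIndependent R′
    R′-ind d e i = trans (sym (Vec.insertAt-punchIn d l 0# i)) (R-ind (lift d) (≈-trans (·-lift d) e) (punchIn l i))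
    meets-trivially : ∀ μ v → ⟨ R′ ⟩ v → v ≈ (μ *v (c · R)) → μ ≡ 0#
    meets-trivially μ v (d , v≈) v≈μcR = *-cancelˡ-0 (c l) μ cₗ≢0 (trans (*-comm (c l) μ) (trans (μc≈lift l) (Vec.insertAt-lookup d l 0#)))
      where
      μc≈lift : (μ *v c) ≈ lift d
      μc≈lift = ·-injective R R-ind _ _ (≈-trans (·-* μ c R) (≈-trans (≈-sym v≈μcR) (≈-trans v≈ (≈-sym (·-lift d)))))

  dot : ∀ {n} → Vect n → Vect n → F
  dot c μ = ∑ (λ i → c i * μ i)

  rowMultiples : ∀ {m n} → Vect n → Vect m → Mat m n
  rowMultiples w μ i = μ i *v w

  ·-rowMultiples : ∀ {m n} (w : Vect n) (μ c : Vect m) → (c · rowMultiples w μ) ≈ (dot c μ *v w)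
  ·-rowMultiples w μ c j = trans (∑-cong (λ i → sym (*-assoc (c i) (μ i) (w j)))) (∑-*ʳ (w j) (λ i → c i * μ i))

  ⟨rowMultiples⟩⊆⟨row⟩ : ∀ {m n} (w : Vect n) (μ : Vect m) → ⟨ rowMultiples w μ ⟩ ⊆ ⟨ row w ⟩
  ⟨rowMultiples⟩⊆⟨row⟩ w μ v (c , v≈) =
    ⟨⟩-resp {M = row w} (≈-sym (≈-trans v≈ (·-rowMultiples w μ c))) (⟨row⟩-multiple w (dot c μ))

  ⟨rowMultiples⟩≐⟨row⟩ : ∀ {m n} (w : Vect n) (μ : Vect m) → Nonzero μ → ⟨ rowMultiples w μ ⟩ ≐ ⟨ row w ⟩
  ⟨rowMultiples⟩≐⟨row⟩ w μ (i , μᵢ≢0) v = ⟨rowMultiples⟩⊆⟨row⟩ w μ v , from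
    where
    from : ⟨ row w ⟩ v → ⟨ rowMultiples w μ ⟩ v
    from v∈w = ⟨⟩-resp {M = rowMultiples w μ} (λ j → sym (trans (proj₂ (⟨row⟩⇒multiple v∈w) j) (sym (rescale j))))
                       (⟨⟩-* {M = rowMultiples w μ} (λ′ * inv (μ i) μᵢ≢0) (⟨⟩-row (rowMultiples w μ) i))
      where
      λ′ = proj₁ (⟨row⟩⇒multiple v∈w)
      rescale : ∀ j → ((λ′ * inv (μ i) μᵢ≢0) * (μ i * w j)) ≡ (λ′ * w j)
      rescale j = begin
          (λ′ * inv (μ i) μᵢ≢0) * (μ i * w j)   ≡⟨ solve 4 (λ a b c d → (a :* b) :* (c :* d) := a :* ((c :* b) :* d)) refl λ′ _ (μ i) (w j) ⟩
          λ′ * ((μ i * inv (μ i) μᵢ≢0) * w j)   ≡⟨ cong (λ x → λ′ * (x * w j)) (inv-inverseʳ (μ i) μᵢ≢0) ⟩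
          λ′ * (1# * w j)                        ≡⟨ cong (λ′ *_) (*-identityˡ (w j)) ⟩
          λ′ * w j                               ∎
        where open ≡-Reasoning

  ⊆⟨row⟩⇒rowMultiples : ∀ {m n} {w : Vect n} (U : Mat m n) → (∀ i → ⟨ row w ⟩ (U i)) → ∃[ μ ] (U ≈ₘ rowMultiples w μ)
  ⊆⟨row⟩⇒rowMultiples U rows = (λ i → proj₁ (⟨row⟩⇒multiple (rows i))) , (λ i → proj₂ (⟨row⟩⇒multiple (rows i)))

  2×n-rank-1 : ∀ {n} (M : Mat 2 n) (x : Vect 2) → Nonzero x → (x · M) ≈ 0v → ¬ (M ≈ₘ 0ₘ) →
               ∃[ r ] ∃[ α ] (Nonzero r × M ≈ₘ rowMultiples r α)
  2×n-rank-1 M x x≢0 x·M≈0 M≉0 with x 0F ≟ 0#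
  ... | no x₀≢0 = M 1F , α , ≉0⇒Nonzero M₁≉0 , λ { 0F → row₀ ; 1F → λ j → sym (*-identityˡ _) }
    where
    α : Vect 2
    α 0F = (- inv (x 0F) x₀≢0) * x 1F
    α 1F = 1#
    row₀ : ∀ j → M 0F j ≡ (α 0F * M 1F j)
    row₀ j = trans (solve-linear (x 0F) x₀≢0 _ ((x 1F * M 1F j) + 0#) (trans (+-comm _ _) (x·M≈0 j)))
                   (trans (cong ((- inv (x 0F) x₀≢0) *_) (+-identityʳ _)) (sym (*-assoc _ _ _)))
    M₁≉0 : ¬ (M 1F ≈ 0v)
    M₁≉0 M₁≈0 = M≉0 λ { 0F j → trans (row₀ j) (trans (cong (α 0F *_) (M₁≈0 j)) (zeroʳ _)) ; 1F → M₁≈0 }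
  ... | yes x₀≡0 = M 0F , α , ≉0⇒Nonzero M₀≉0 , λ { 0F → λ j → sym (*-identityˡ _) ; 1F → λ j → trans (row₁≡0 j) (sym (zeroˡ _)) }
    where
    α : Vect 2
    α 0F = 1#
    α 1F = 0#
    x₁≢0 : ¬ (x 1F ≡ 0#)
    x₁≢0 = nonzero-at-1 x≢0
      where
      nonzero-at-1 : Nonzero x → ¬ (x 1F ≡ 0#)
      nonzero-at-1 (0F , x₀≢0) = ⊥-elim (x₀≢0 x₀≡0)
      nonzero-at-1 (1F , x₁≢0) = x₁≢0
    row₁≡0 : ∀ j → M 1F j ≡ 0#
    row₁≡0 j = *-cancelˡ-0 (x 1F) (M 1F j) x₁≢0
      (trans (sym (solve 3 (λ a b c → con (ℤ.+ 0) :* a :+ (b :* c :+ con (ℤ.+ 0)) := b :* c) refl (M 0F j) (x 1F) (M 1F j)))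
             (trans (cong (λ t → (t * M 0F j) + ((x 1F * M 1F j) + 0#)) (sym x₀≡0)) (x·M≈0 j)))
    M₀≉0 : ¬ (M 0F ≈ 0v)
    M₀≉0 M₀≈0 = M≉0 λ { 0F → M₀≈0 ; 1F → row₁≡0 }

  HasRank-<⇒LeftKer≢0 : ∀ {m n r} (D : Mat m n) → HasRank D r → r ℕ.< m → ∃[ z ] (Nonzero z × LeftKer D z)
  HasRank-<⇒LeftKer≢0 D (B , _ , D≐B) r<m = ⊆⟨⟩⇒dependent D B r<m (λ i → proj₁ (D≐B (D i)) (⟨⟩-row D i))


  IsRREF⇒independent : ∀ {m n} (M : Mat m n) → IsRREF M → RowsIndependent M
  IsRREF⇒independent M (pivot , _ , pivot-one , pivot-column , _) c e i =
    trans (sym (trans (∑-cong (λ t → cong (c t *_) (M-pivot≡Iₘ t i))) (∑-Iₘʳ i c))) (e (pivot i))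
    where
    M-pivot≡Iₘ : ∀ t i → M t (pivot i) ≡ Iₘ t i
    M-pivot≡Iₘ t i with t Fin.≟ i
    ... | yes refl = pivot-one t
    ... | no t≢i = pivot-column i t (λ i≡t → t≢i (sym i≡t))

  -- Vectors of F^6 = F^3 × F^3 and the subspace S

  infixr 5 _∥_

  _∥_ : Vect 3 → Vect 3 → Vect 6
  (a ∥ b) 0F = a 0F
  (a ∥ b) 1F = a 1F
  (a ∥ b) 2F = a 2F
  (a ∥ b) 3F = b 0F
  (a ∥ b) 4F = b 1F
  (a ∥ b) 5F = b 2F

  fst₆ : Vect 6 → Vect 3
  fst₆ v 0F = v 0F
  fst₆ v 1F = v 1F
  fst₆ v 2F = v 2F

  snd₆ : Vect 6 → Vect 3
  snd₆ v 0F = v 3F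
  snd₆ v 1F = v 4F
  snd₆ v 2F = v 5F

  fst₆-cong : ∀ {u v} → u ≈ v → fst₆ u ≈ fst₆ v
  fst₆-cong e 0F = e 0F
  fst₆-cong e 1F = e 1F
  fst₆-cong e 2F = e 2F

  ∥-cong : ∀ {a a′ b b′} → a ≈ a′ → b ≈ b′ → (a ∥ b) ≈ (a′ ∥ b′)
  ∥-cong e f 0F = e 0F
  ∥-cong e f 1F = e 1F
  ∥-cong e f 2F = e 2F
  ∥-cong e f 3F = f 0F
  ∥-cong e f 4F = f 1F
  ∥-cong e f 5F = f 2F

  ∥-split : ∀ v → v ≈ (fst₆ v ∥ snd₆ v)
  ∥-split v 0F = refl
  ∥-split v 1F = refl
  ∥-split v 2F = refl
  ∥-split v 3F = refl
  ∥-split v 4F = refl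
  ∥-split v 5F = refl

  ∥-injective : ∀ {a b a′ b′} → (a ∥ b) ≈ (a′ ∥ b′) → (a ≈ a′) × (b ≈ b′)
  ∥-injective e = (λ { 0F → e 0F ; 1F → e 1F ; 2F → e 2F }) , (λ { 0F → e 3F ; 1F → e 4F ; 2F → e 5F })

  0∥0 : (0v ∥ 0v) ≈ 0v
  0∥0 0F = refl
  0∥0 1F = refl
  0∥0 2F = refl
  0∥0 3F = refl
  0∥0 4F = refl
  0∥0 5F = refl

  ∥-+ : ∀ a b a′ b′ → ((a ∥ b) +v (a′ ∥ b′)) ≈ ((a +v a′) ∥ (b +v b′))
  ∥-+ a b a′ b′ 0F = refl
  ∥-+ a b a′ b′ 1F = refl
  ∥-+ a b a′ b′ 2F = refl
  ∥-+ a b a′ b′ 3F = refl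
  ∥-+ a b a′ b′ 4F = refl
  ∥-+ a b a′ b′ 5F = refl

  ∥-* : ∀ t a b → (t *v (a ∥ b)) ≈ ((t *v a) ∥ (t *v b))
  ∥-* t a b 0F = refl
  ∥-* t a b 1F = refl
  ∥-* t a b 2F = refl
  ∥-* t a b 3F = refl
  ∥-* t a b 4F = refl
  ∥-* t a b 5F = refl

  ∥-neg : ∀ a b → (-v (a ∥ b)) ≈ ((-v a) ∥ (-v b))
  ∥-neg a b 0F = refl
  ∥-neg a b 1F = refl
  ∥-neg a b 2F = refl
  ∥-neg a b 3F = refl
  ∥-neg a b 4F = refl
  ∥-neg a b 5F = refl

  ·-hcat : ∀ {m} (c : Vect m) (M N : Mat m 3) → (c · hcat {k = 3} M N) ≈ ((c · M) ∥ (c · N))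
  ·-hcat c M N 0F = refl
  ·-hcat c M N 1F = refl
  ·-hcat c M N 2F = refl
  ·-hcat c M N 3F = refl
  ·-hcat c M N 4F = refl
  ·-hcat c M N 5F = refl

  hcat-row : ∀ {m} (M N : Mat m 3) i → hcat {k = 3} M N i ≈ (M i ∥ N i)
  hcat-row M N i 0F = refl
  hcat-row M N i 1F = refl
  hcat-row M N i 2F = refl
  hcat-row M N i 3F = refl
  hcat-row M N i 4F = refl
  hcat-row M N i 5F = refl

  S⇒fst₆≈0 : ∀ {v} → S v → fst₆ v ≈ 0v
  S⇒fst₆≈0 (c , v≈) 0F = trans (v≈ 0F) (·-zeroʳ {n = 6} c 0F)
  S⇒fst₆≈0 (c , v≈) 1F = trans (v≈ 1F) (·-zeroʳ {n = 6} c 1F)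
  S⇒fst₆≈0 (c , v≈) 2F = trans (v≈ 2F) (·-zeroʳ {n = 6} c 2F)

  S-∥ : ∀ s → S (0v ∥ s)
  S-∥ s = s , ≈-trans (∥-cong (≈-sym (·-zeroʳ {n = 3} s)) (≈-sym (·-Iₘʳ s))) (≈-sym (·-hcat s 0ₘ Iₘ))

  S-resp : ∀ {u v} → u ≈ v → S u → S v
  S-resp = ⟨⟩-resp {M = Smat}

module MRDCodeLines (K : FiniteField) where
  open LinearAlgebra K

  -- the line B + 𝒰 of AG_ℓ(2,3,q) whose point at infinity is ⟨ w ⟩
  IsLineAlong : MatSet 2 3 → Mat 2 3 → Vect 3 → Set
  IsLineAlong 𝒳 B w = ∀ M → (𝒳 M → ∃[ μ ] (M ≈ₘ (B +ₘ rowMultiples w μ)))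
                           × (∃[ μ ] (M ≈ₘ (B +ₘ rowMultiples w μ)) → 𝒳 M)

  IsLineWith⇒IsLineAlong : ∀ {𝒳 B W} → IsLineWith 𝒳 B W → ∃[ w ] (Nonzero w × W ≐ ⟨ row w ⟩ × IsLineAlong 𝒳 B w)
  IsLineWith⇒IsLineAlong {𝒳} {B} (W-dim , 𝒳≐) = w , w≢0 , W≐w , along
    where
    w = proj₁ (HasDim-1⇒line W-dim)
    w≢0 = proj₁ (proj₂ (HasDim-1⇒line W-dim))
    W≐w = proj₂ (proj₂ (HasDim-1⇒line W-dim))
    along : IsLineAlong 𝒳 B w
    along M = to , from
      where
      to : 𝒳 M → ∃[ μ ] (M ≈ₘ (B +ₘ rowMultiples w μ))
      to M∈𝒳 with proj₁ (𝒳≐ M) M∈𝒳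
      ... | U , U⊆W , M≈ with ⊆⟨row⟩⇒rowMultiples U (λ i → proj₁ (W≐w (U i)) (U⊆W (U i) (⟨⟩-row U i)))
      ... | μ , U≈ = μ , λ i j → trans (M≈ i j) (cong (B i j +_) (U≈ i j))
      from : ∃[ μ ] (M ≈ₘ (B +ₘ rowMultiples w μ)) → 𝒳 M
      from (μ , M≈) = proj₂ (𝒳≐ M) (rowMultiples w μ , (λ v v∈ → proj₂ (W≐w v) (⟨rowMultiples⟩⊆⟨row⟩ w μ v v∈)) , M≈)

  IsLineAlong⇒IsLineWith : ∀ {𝒳 B w} → Nonzero w → IsLineAlong 𝒳 B w → IsLineWith 𝒳 B ⟨ row w ⟩
  IsLineAlong⇒IsLineWith {𝒳} {B} {w} w≢0 along = HasDim-⟨⟩ (row w) (row-independent w≢0) , λ M → to M , from M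
    where
    to : ∀ M → 𝒳 M → ∃[ U ] (⟨ U ⟩ ⊆ ⟨ row w ⟩ × M ≈ₘ (B +ₘ U))
    to M M∈𝒳 with proj₁ (along M) M∈𝒳
    ... | μ , M≈ = rowMultiples w μ , ⟨rowMultiples⟩⊆⟨row⟩ w μ , M≈
    from : ∀ M → ∃[ U ] (⟨ U ⟩ ⊆ ⟨ row w ⟩ × M ≈ₘ (B +ₘ U)) → 𝒳 M
    from M (U , U⊆w , M≈) with ⊆⟨row⟩⇒rowMultiples U (λ i → U⊆w (U i) (⟨⟩-row U i))
    ... | μ , U≈ = proj₂ (along M) (μ , λ i j → trans (M≈ i j) (cong (B i j +_) (U≈ i j)))

  LeftKernelVectors : (Fin 2 → Mat 3 3) → Subset 3
  LeftKernelVectors Ds z = ∃[ D ] (MatSpan Ds D × ¬ (D ≈ₘ 0ₘ) × LeftKer D z)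

  module Planes (Z : Mat 2 3) (Z-ind : RowsIndependent Z) where

    planeGen : Mat 2 3 → Mat 2 6
    planeGen M = hcat {k = 3} Z M

    plane : Mat 2 3 → Subset 6
    plane M = ⟨ planeGen M ⟩

    planeGen-independent : ∀ M → RowsIndependent (planeGen M)
    planeGen-independent M c e = Z-ind c (proj₁ (∥-injective (≈-trans (≈-sym (·-hcat c Z M)) (≈-trans e (≈-sym 0∥0)))))

    plane-dim : ∀ M → HasDim (plane M) 2
    plane-dim M = HasDim-⟨⟩ (planeGen M) (planeGen-independent M)

    plane∩S≈0 : ∀ M v → plane M v → S v → v ≈ 0v
    plane∩S≈0 M v (x , v≈) v∈S = ≈-trans v≈ (≈-trans (·-hcat x Z M) (≈-trans (∥-cong x·Z≈0 (≈-trans (·-cong M x≈0) (·-zeroˡ M))) 0∥0))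
      where
      x·Z≈0 : (x · Z) ≈ 0v
      x·Z≈0 j = trans (sym (proj₁ (∥-injective (≈-trans (≈-sym (∥-split v)) (≈-trans v≈ (·-hcat x Z M)))) j)) (S⇒fst₆≈0 v∈S j)
      x≈0 : x ≈ 0v
      x≈0 = Z-ind x x·Z≈0

    plane-cong : ∀ {M M′} → M ≈ₘ M′ → plane M ≐ plane M′
    plane-cong {M} {M′} e = ⟨⟩-congₘ λ i → ≈-trans (hcat-row Z M i) (≈-trans (∥-cong ≈-refl (e i)) (≈-sym (hcat-row Z M′ i)))

    plane-injective : ∀ {M M′} → plane M ≐ plane M′ → M ≈ₘ M′
    plane-injective {M} {M′} e i with proj₁ (e (planeGen M i)) (⟨⟩-row (planeGen M) i)
    ... | c , row≈ = ≈-trans (proj₂ halves) (≈-trans (·-cong M′ c≈Iᵢ) (·-Iₘˡ i M′))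
      where
      halves = ∥-injective (≈-trans (≈-sym (hcat-row Z M i)) (≈-trans row≈ (·-hcat c Z M′)))
      c≈Iᵢ : c ≈ Iₘ i
      c≈Iᵢ = ·-injective Z Z-ind c (Iₘ i) (≈-trans (≈-sym (proj₁ halves)) (≈-sym (·-Iₘˡ i Z)))

    fst₆-·-Hmat : ∀ d → fst₆ (d · Hmat Z) ≈ (Vec.take 2 d · Z)
    fst₆-·-Hmat d = column
      where
      drop-zeros : ∀ p q a b c → (p + (q + ((a * 0#) + ((b * 0#) + ((c * 0#) + 0#))))) ≡ (p + (q + 0#))
      drop-zeros = solve 5 (λ p q a b c → p :+ (q :+ (a :* con (ℤ.+ 0) :+ (b :* con (ℤ.+ 0) :+ (c :* con (ℤ.+ 0) :+ con (ℤ.+ 0)))))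
                                          := p :+ (q :+ con (ℤ.+ 0))) refl
      column : fst₆ (d · Hmat Z) ≈ (Vec.take 2 d · Z)
      column 0F = drop-zeros (d 0F * Z 0F 0F) (d 1F * Z 1F 0F) (d 2F) (d 3F) (d 4F)
      column 1F = drop-zeros (d 0F * Z 0F 1F) (d 1F * Z 1F 1F) (d 2F) (d 3F) (d 4F)
      column 2F = drop-zeros (d 0F * Z 0F 2F) (d 1F * Z 1F 2F) (d 2F) (d 3F) (d 4F)

    E∩H≐plane : ∀ A → (E A ∩ H Z) ≐ plane (Z ⊗ A)
    E∩H≐plane A v = to , from
      where
      to : (E A ∩ H Z) v → plane (Z ⊗ A) v
      to ((c , v≈) , (d , v≈′)) = x , ≈-trans v≈c∥cA (≈-trans (∥-cong c≈x·Z (≈-trans (·-cong A c≈x·Z) (≈-sym (·-⊗ x Z A))))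
                                                               (≈-sym (·-hcat x Z (Z ⊗ A))))
        where
        x = Vec.take 2 d
        v≈c∥cA : v ≈ (c ∥ (c · A))
        v≈c∥cA = ≈-trans v≈ (≈-trans (·-hcat c Iₘ A) (∥-cong (·-Iₘʳ c) ≈-refl))
        c≈x·Z : c ≈ (x · Z)
        c≈x·Z j = trans (proj₁ (∥-injective (≈-trans (≈-sym v≈c∥cA) (∥-split v))) j)
                        (trans (fst₆-cong v≈′ j) (fst₆-·-Hmat d j))
      from : plane (Z ⊗ A) v → (E A ∩ H Z) v
      from (x , v≈) = ((x · Z) , ≈-trans v≈x·Z∥u (≈-sym (≈-trans (·-hcat (x · Z) Iₘ A) (∥-cong (·-Iₘʳ (x · Z)) (≈-sym (·-⊗ x Z A))))))
                    , ⟨⟩-resp {M = Hmat Z} (≈-sym v≈sum)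
                        (⟨⟩-+ {M = Hmat Z} (⟨⟩-mono {M = hcat {k = 3} Z 0ₘ} {N = Hmat Z} (λ { 0F → ⟨⟩-row (Hmat Z) 0F ; 1F → ⟨⟩-row (Hmat Z) 1F }) _
                                                     (⟨⟩-· (hcat {k = 3} Z 0ₘ) x))
                                           (⟨⟩-mono {M = Smat} {N = Hmat Z} (λ { 0F → ⟨⟩-row (Hmat Z) 2F ; 1F → ⟨⟩-row (Hmat Z) 3F ; 2F → ⟨⟩-row (Hmat Z) 4F }) _
                                                     (⟨⟩-· Smat u)))
        where
        u = x · (Z ⊗ A)
        v≈x·Z∥u : v ≈ ((x · Z) ∥ u)
        v≈x·Z∥u = ≈-trans v≈ (·-hcat x Z (Z ⊗ A))
        v≈sum : v ≈ ((x · hcat {k = 3} Z 0ₘ) +v (u · Smat))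
        v≈sum = ≈-trans v≈x·Z∥u (≈-sym (≈-trans (λ j → cong₂ _+_ (·-hcat x Z 0ₘ j) (·-hcat u 0ₘ Iₘ j))
                  (≈-trans (∥-+ _ _ _ _) (∥-cong (λ j → trans (cong ((x · Z) j +_) (·-zeroʳ {n = 3} u j)) (+-identityʳ _))
                                                 (λ j → trans (cong (_+ (u · Iₘ) j) (·-zeroʳ {n = 3} x j)) (trans (+-identityˡ _) (·-Iₘʳ u j)))))))

    -- for B = Z A₀ this is Nmat Z A₀ w
    NGen : Mat 2 3 → Vect 3 → Mat 3 6
    NGen B w = vcat {m = 2} (hcat {k = 3} Z B) (hcat {k = 3} 0ₘ (row w))

    ·-NGen : ∀ B w c → (c · NGen B w) ≈ ((Vec.take 2 c · Z) ∥ ((Vec.take 2 c · B) +v (c 2F *v w)))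
    ·-NGen B w c = λ { 0F → left _ _ ; 1F → left _ _ ; 2F → left _ _ ; 3F → right _ _ _ ; 4F → right _ _ _ ; 5F → right _ _ _ }
      where
      left : ∀ p q → (p + (q + ((c 2F * 0#) + 0#))) ≡ (p + (q + 0#))
      left p q = solve 3 (λ p q a → p :+ (q :+ (a :* con (ℤ.+ 0) :+ con (ℤ.+ 0))) := p :+ (q :+ con (ℤ.+ 0))) refl p q (c 2F)
      right : ∀ p q r → (p + (q + (r + 0#))) ≡ ((p + (q + 0#)) + r)
      right = solve 3 (λ p q r → p :+ (q :+ (r :+ con (ℤ.+ 0))) := p :+ (q :+ con (ℤ.+ 0)) :+ r) refl

    take₂·-≈0 : ∀ (c : Vect 3) → Vec.take 2 c ≈ 0v → (B : Mat 2 3) → (Vec.take 2 c · B) ≈ 0v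
    take₂·-≈0 c e B = ≈-trans (·-cong B e) (·-zeroˡ B)

    NGen-independent : ∀ B {w} → Nonzero w → RowsIndependent (NGen B w)
    NGen-independent B {w} w≢0 c e = λ { 0F → c₀₁≈0 0F ; 1F → c₀₁≈0 1F ; 2F → c₂≡0 }
      where
      halves = ∥-injective (≈-trans (≈-sym (·-NGen B w c)) (≈-trans e (≈-sym 0∥0)))
      c₀₁≈0 : Vec.take 2 c ≈ 0v
      c₀₁≈0 = Z-ind (Vec.take 2 c) (proj₁ halves)
      c₂≡0 : c 2F ≡ 0#
      c₂≡0 = *v-cancelʳ-0 (c 2F) w≢0 λ j →
        trans (sym (+-identityˡ _)) (trans (cong (_+ (c 2F * w j)) (sym (take₂·-≈0 c c₀₁≈0 B j))) (proj₂ halves j))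

    ·-pad : ∀ w c → (c · pad w) ≈ (0v ∥ (c 0F *v w))
    ·-pad w c = λ { 0F → zero-col ; 1F → zero-col ; 2F → zero-col ; 3F → +-identityʳ _ ; 4F → +-identityʳ _ ; 5F → +-identityʳ _ }
      where
      zero-col : ((c 0F * 0#) + 0#) ≡ 0#
      zero-col = trans (+-identityʳ _) (zeroʳ (c 0F))

    pad-independent : ∀ {w} → Nonzero w → RowsIndependent (pad w)
    pad-independent {w} w≢0 c e 0F = *v-cancelʳ-0 (c 0F) w≢0 (proj₂ (∥-injective (≈-trans (≈-sym (·-pad w c)) (≈-trans e (≈-sym 0∥0)))))

    ⟨NGen⟩∩S≐pad : ∀ B {w} → Nonzero w → (⟨ NGen B w ⟩ ∩ S) ≐ ⟨ pad w ⟩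
    ⟨NGen⟩∩S≐pad B {w} w≢0 v = to , from
      where
      to : (⟨ NGen B w ⟩ ∩ S) v → ⟨ pad w ⟩ v
      to ((c , v≈) , v∈S) = (λ _ → c 2F) , ≈-trans v≈ (≈-trans (·-NGen B w c) (≈-trans (∥-cong c·Z≈0 c·B+≈) (≈-sym (·-pad w (λ _ → c 2F)))))
        where
        c·Z≈0 : (Vec.take 2 c · Z) ≈ 0v
        c·Z≈0 j = trans (proj₁ (∥-injective (≈-trans (≈-sym (≈-trans v≈ (·-NGen B w c))) (∥-split v))) j) (S⇒fst₆≈0 v∈S j)
        c·B+≈ : ((Vec.take 2 c · B) +v (c 2F *v w)) ≈ (c 2F *v w)
        c·B+≈ j = trans (cong (_+ (c 2F * w j)) (take₂·-≈0 c (Z-ind (Vec.take 2 c) c·Z≈0) B j)) (+-identityˡ _)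
      from : ⟨ pad w ⟩ v → (⟨ NGen B w ⟩ ∩ S) v
      from (c , v≈) = (c′ , ≈-trans v≈pad (≈-sym (≈-trans (·-NGen B w c′) (∥-cong (take₂·-≈0 c′ c′₀₁≈0 Z) c′·B+≈))))
                    , S-resp (≈-sym v≈pad) (S-∥ (c 0F *v w))
        where
        c′ : Vect 3
        c′ 0F = 0#
        c′ 1F = 0#
        c′ 2F = c 0F
        c′₀₁≈0 : Vec.take 2 c′ ≈ 0v
        c′₀₁≈0 = λ { 0F → refl ; 1F → refl }
        c′·B+≈ : ((Vec.take 2 c′ · B) +v (c 0F *v w)) ≈ (c 0F *v w)
        c′·B+≈ j = trans (cong (_+ (c 0F * w j)) (take₂·-≈0 c′ c′₀₁≈0 B j)) (+-identityˡ _)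
        v≈pad : v ≈ (0v ∥ (c 0F *v w))
        v≈pad = ≈-trans v≈ (·-pad w c)

    plane⊆⟨NGen⟩ : ∀ B w μ → plane (B +ₘ rowMultiples w μ) ⊆ ⟨ NGen B w ⟩
    plane⊆⟨NGen⟩ B w μ v (x , v≈) = x′ , ≈-trans v≈ (≈-trans (·-hcat x Z (B +ₘ rowMultiples w μ))
        (≈-trans (∥-cong ≈-refl (≈-trans (·-+ₘ x B (rowMultiples w μ)) (λ j → cong ((x · B) j +_) (·-rowMultiples w μ x j))))
                 (≈-sym (·-NGen B w x′))))
      where
      x′ : Vect 3
      x′ 0F = x 0F
      x′ 1F = x 1F
      x′ 2F = dot x μ

    ⊆⟨NGen⟩⇒plane : ∀ B {w} {L : Subset 6} → L ⊆ ⟨ NGen B w ⟩ → HasDim L 2 → (∀ v → L v → S v → v ≈ 0v) →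
                    ∃[ μ ] (L ≐ plane (B +ₘ rowMultiples w μ))
    ⊆⟨NGen⟩⇒plane B {w} {L} L⊆N (Bₗ , Bₗ-ind , L≐Bₗ) L∩S≈0 =
      μ , HasDim-basis (Bₗ , Bₗ-ind , L≐Bₗ) (planeGen (B +ₘ rowMultiples w μ)) (planeGen-independent _) rows∈L
      where
      -- coordinates of the basis of L with respect to NGen B w
      X : Mat 2 3
      X i = proj₁ (L⊆N (Bₗ i) (proj₂ (L≐Bₗ (Bₗ i)) (⟨⟩-row Bₗ i)))
      ·-Bₗ : ∀ d → (d · Bₗ) ≈ ((d · X) · NGen B w)
      ·-Bₗ d = ≈-trans (·-congₘ d {Bₗ} {X ⊗ NGen B w} (λ i → proj₂ (L⊆N (Bₗ i) (proj₂ (L≐Bₗ (Bₗ i)) (⟨⟩-row Bₗ i)))))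
                       (·-⊗ d X (NGen B w))
      P : Mat 2 2
      P i = Vec.take 2 (X i)
      take₂-·X : ∀ d → Vec.take 2 (d · X) ≈ (d · P)
      take₂-·X d 0F = refl
      take₂-·X d 1F = refl
      P-ind : RowsIndependent P
      P-ind d d·P≈0 = Bₗ-ind d (L∩S≈0 (d · Bₗ) (proj₂ (L≐Bₗ _) (⟨⟩-· Bₗ d)) (S-resp (≈-sym d·Bₗ≈) (S-∥ _)))
        where
        take₂≈0 = ≈-trans (take₂-·X d) d·P≈0
        d·Bₗ≈ : (d · Bₗ) ≈ (0v ∥ ((d · X) 2F *v w))
        d·Bₗ≈ = ≈-trans (·-Bₗ d) (≈-trans (·-NGen B w (d · X))
                  (∥-cong (take₂·-≈0 (d · X) take₂≈0 Z)
                          (λ j → trans (cong (_+ ((d · X) 2F * w j)) (take₂·-≈0 (d · X) take₂≈0 B j)) (+-identityˡ _))))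
      Q : Mat 2 2
      Q i = proj₁ (independent-square-spans P P-ind (Iₘ i))
      take₂-QX : ∀ i → Vec.take 2 (Q i · X) ≈ Iₘ i
      take₂-QX i = ≈-trans (take₂-·X (Q i)) (≈-sym (proj₂ (independent-square-spans P P-ind (Iₘ i))))
      μ : Vect 2
      μ i = (Q i · X) 2F
      rows∈L : ∀ i → L (planeGen (B +ₘ rowMultiples w μ) i)
      rows∈L i = proj₂ (L≐Bₗ _) (⟨⟩-resp {M = Bₗ} (≈-sym row≈) (⟨⟩-· Bₗ (Q i)))
        where
        row≈ : planeGen (B +ₘ rowMultiples w μ) i ≈ (Q i · Bₗ)
        row≈ = ≈-trans (hcat-row Z (B +ₘ rowMultiples w μ) i) (≈-sym (≈-trans (·-Bₗ (Q i)) (≈-trans (·-NGen B w (Q i · X))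
                 (∥-cong (≈-trans (·-cong Z (take₂-QX i)) (·-Iₘˡ i Z))
                         (λ j → cong (_+ (μ i * w j)) (trans (·-cong B (take₂-QX i) j) (·-Iₘˡ i B j)))))))

  module MRDCode (𝒜 : MatSet 3 3) (mrd : IsLinearMRD332 𝒜) (Z : Mat 2 3) (Z-rref : IsRREF Z) where

    𝒜-resp : RespectsMat 𝒜
    𝒜-resp = proj₁ (proj₁ mrd)

    𝒜-0 : 𝒜 0ₘ
    𝒜-0 = proj₁ (proj₂ (proj₁ mrd))

    𝒜-+ : ∀ {M N} → 𝒜 M → 𝒜 N → 𝒜 (M +ₘ N)
    𝒜-+ = proj₁ (proj₂ (proj₂ (proj₁ mrd))) _ _

    𝒜-• : ∀ a {M} → 𝒜 M → 𝒜 (a •ₘ M)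
    𝒜-• a = proj₂ (proj₂ (proj₂ (proj₁ mrd))) a _

    𝒜-rank : ∀ M → 𝒜 M → ¬ (M ≈ₘ 0ₘ) → RankAtLeast M 2
    𝒜-rank = proj₂ (proj₂ mrd)

    _−ₘ_ : Mat 3 3 → Mat 3 3 → Mat 3 3
    M −ₘ N = M +ₘ ((- 1#) •ₘ N)

    𝒜-− : ∀ {M N} → 𝒜 M → 𝒜 N → 𝒜 (M −ₘ N)
    𝒜-− M∈𝒜 N∈𝒜 = 𝒜-+ M∈𝒜 (𝒜-• (- 1#) N∈𝒜)

    𝒜-lincomb : ∀ {k} (c : Vect k) (Ds : Fin k → Mat 3 3) → (∀ t → 𝒜 (Ds t)) → 𝒜 (lincombₘ c Ds)
    𝒜-lincomb {zero} c Ds Ds⊆𝒜 = 𝒜-resp (λ i j → refl) 𝒜-0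
    𝒜-lincomb {suc k} c Ds Ds⊆𝒜 =
      𝒜-resp (λ i j → refl) (𝒜-+ (𝒜-• (c zero) (Ds⊆𝒜 zero)) (𝒜-lincomb (Vec.tail c) (Vec.tail Ds) (λ t → Ds⊆𝒜 (suc t))))

    Z-independent : RowsIndependent Z
    Z-independent = IsRREF⇒independent Z Z-rref

    open Planes Z Z-independent public

    Z⊗-cong : ∀ {A B : Mat 3 3} → A ≈ₘ B → (Z ⊗ A) ≈ₘ (Z ⊗ B)
    Z⊗-cong e i = ·-congₘ (Z i) e

    Z⊗-+ₘ : ∀ (A B : Mat 3 3) → (Z ⊗ (A +ₘ B)) ≈ₘ ((Z ⊗ A) +ₘ (Z ⊗ B))
    Z⊗-+ₘ A B i = ·-+ₘ (Z i) A B

    Z⊗-−ₘ : ∀ (A B : Mat 3 3) → (Z ⊗ (A −ₘ B)) ≈ₘ ((Z ⊗ A) +ₘ (λ i j → - (Z ⊗ B) i j))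
    Z⊗-−ₘ A B i j = trans (·-+ₘ (Z i) A ((- 1#) •ₘ B) j) (cong ((Z ⊗ A) i j +_) (trans (·-•ₘ (Z i) (- 1#) B j) (-1*x≈-x _)))

    Z⊗-lincomb : ∀ {k} (c : Vect k) (Ds : Fin k → Mat 3 3) → (Z ⊗ lincombₘ c Ds) ≈ₘ lincombₘ c (λ t → Z ⊗ Ds t)
    Z⊗-lincomb c Ds i = ·-lincombₘ (Z i) c Ds

    -- rank 2 ≤ rank A ≤ 1 unless A = 0
    Z⊗≈0⇒≈0 : ∀ {A : Mat 3 3} → 𝒜 A → (Z ⊗ A) ≈ₘ 0ₘ → A ≈ₘ 0ₘ
    Z⊗≈0⇒≈0 {A} A∈𝒜 ZA≈0 with A ≟ₘ 0ₘ
    ... | yes A≈0 = A≈0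
    ... | no A≉0 with 𝒜-rank A A∈𝒜 A≉0
    ... | d , 2≤d , rank-d = ⊥-elim (ℕP.<⇒≱ 2≤d (HasRank-≤-1 Z Z-independent A ZA≈0 rank-d))

    Z⊗-injective : ∀ {A B : Mat 3 3} → 𝒜 A → 𝒜 B → (Z ⊗ A) ≈ₘ (Z ⊗ B) → A ≈ₘ B
    Z⊗-injective {A} {B} A∈𝒜 B∈𝒜 ZA≈ZB i j =
      x∙y⁻¹≈ε⇒x≈y _ _ (trans (cong (A i j +_) (sym (-1*x≈-x (B i j))))
                             (Z⊗≈0⇒≈0 (𝒜-− A∈𝒜 B∈𝒜) (λ i′ j′ → trans (Z⊗-−ₘ A B i′ j′) (x≈y⇒x∙y⁻¹≈ε (ZA≈ZB i′ j′))) i j))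

    module Conditions (𝓡 : MatSet 3 3) (𝓡-resp : RespectsMat 𝓡) (𝓡⊆𝒜 : 𝓡 ⊆ₘ 𝒜) where

      ZR-∈ : ∀ {A} → 𝓡 A → ZR Z 𝓡 (Z ⊗ A)
      ZR-∈ {A} A∈𝓡 = A , A∈𝓡 , λ i j → refl

      along⇒CondIWith : ∀ {B w} → Nonzero w → IsLineAlong (ZR Z 𝓡) B w → CondIWith Z 𝓡 ⟨ NGen B w ⟩
      along⇒CondIWith {B} {w} w≢0 along =
          HasDim-⟨⟩ (NGen B w) (NGen-independent B w≢0)
        , HasDim-cong (≐-sym (⟨NGen⟩∩S≐pad B w≢0)) (HasDim-⟨⟩ (pad w) (pad-independent w≢0))
        , λ L → to L , from L
        where
        to : ∀ L → ∃[ A ] (𝓡 A × L ≐ (E A ∩ H Z)) → L ⊆ ⟨ NGen B w ⟩ × HasDim L 2 × (∀ v → L v → S v → v ≈ 0v)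
        to L (A , A∈𝓡 , L≐) = (λ v v∈L → plane⊆⟨NGen⟩ B w μ v (proj₁ (L≐plane v) v∈L))
                            , HasDim-cong (≐-sym L≐plane) (plane-dim _)
                            , (λ v v∈L → plane∩S≈0 _ v (proj₁ (L≐plane v) v∈L))
          where
          μ = proj₁ (proj₁ (along (Z ⊗ A)) (ZR-∈ A∈𝓡))
          L≐plane = ≐-trans L≐ (≐-trans (E∩H≐plane A) (plane-cong (proj₂ (proj₁ (along (Z ⊗ A)) (ZR-∈ A∈𝓡)))))
        from : ∀ L → L ⊆ ⟨ NGen B w ⟩ × HasDim L 2 × (∀ v → L v → S v → v ≈ 0v) → ∃[ A ] (𝓡 A × L ≐ (E A ∩ H Z))
        from L (L⊆N , L-dim , L∩S≈0) = A , A∈𝓡 , ≐-trans L≐plane (≐-trans (plane-cong BU≈ZA) (≐-sym (E∩H≐plane A)))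
          where
          μ = proj₁ (⊆⟨NGen⟩⇒plane B {w} {L} L⊆N L-dim L∩S≈0)
          L≐plane = proj₂ (⊆⟨NGen⟩⇒plane B {w} {L} L⊆N L-dim L∩S≈0)
          on-line = proj₂ (along (B +ₘ rowMultiples w μ)) (μ , λ i j → refl)
          A = proj₁ on-line
          A∈𝓡 = proj₁ (proj₂ on-line)
          BU≈ZA = proj₂ (proj₂ on-line)

      module FromCondI {N : Subset 6} (cond : CondIWith Z 𝓡 N) where

        N-basis : Mat 3 6
        N-basis = proj₁ (proj₁ cond)

        N-basis-ind : RowsIndependent N-basis
        N-basis-ind = proj₁ (proj₂ (proj₁ cond))

        N≐ : N ≐ ⟨ N-basis ⟩
        N≐ = proj₂ (proj₂ (proj₁ cond))

        classify : ∀ L → (∃[ A ] (𝓡 A × L ≐ (E A ∩ H Z))) → L ⊆ N × HasDim L 2 × (∀ v → L v → S v → v ≈ 0v)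
        classify L = proj₁ (proj₂ (proj₂ cond) L)

        realise : ∀ L → L ⊆ N × HasDim L 2 × (∀ v → L v → S v → v ≈ 0v) → ∃[ A ] (𝓡 A × L ≐ (E A ∩ H Z))
        realise L = proj₂ (proj₂ (proj₂ cond) L)

        plane⊆N : ∀ {A} → 𝓡 A → plane (Z ⊗ A) ⊆ N
        plane⊆N {A} A∈𝓡 v v∈ = proj₁ (classify (E A ∩ H Z) (A , A∈𝓡 , λ u → (λ x → x) , (λ x → x))) v (proj₂ (E∩H≐plane A v) v∈)

        NGen⊆N : ∀ {A s} → 𝓡 A → N (0v ∥ s) → ⟨ NGen (Z ⊗ A) s ⟩ ⊆ N
        NGen⊆N {A} {s} A∈𝓡 0∥s∈N v v∈ =
          proj₂ (N≐ v) (⟨⟩-mono {M = NGen (Z ⊗ A) s} {N = N-basis} (λ i → proj₁ (N≐ _) (rows∈N i)) v v∈)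
          where
          rows∈N : ∀ i → N (NGen (Z ⊗ A) s i)
          rows∈N 0F = plane⊆N A∈𝓡 _ (⟨⟩-row (planeGen (Z ⊗ A)) 0F)
          rows∈N 1F = plane⊆N A∈𝓡 _ (⟨⟩-row (planeGen (Z ⊗ A)) 1F)
          rows∈N 2F = ≐⟨⟩-resp {M = N-basis} N≐ (≈-sym (hcat-row 0ₘ (row s) 0F)) 0∥s∈N

        0∥difference∈N : ∀ {A A′} → 𝓡 A → 𝓡 A′ → ∀ x → N (0v ∥ ((x · (Z ⊗ A)) +v (-v (x · (Z ⊗ A′)))))
        0∥difference∈N {A} {A′} A∈𝓡 A′∈𝓡 x =
          ≐⟨⟩-resp {M = N-basis} N≐ difference≈ (≐⟨⟩-+ {M = N-basis} N≐ (plane⊆N A∈𝓡 _ (⟨⟩-· (planeGen (Z ⊗ A)) x)) (≐⟨⟩-neg {M = N-basis} N≐ (plane⊆N A′∈𝓡 _ (⟨⟩-· (planeGen (Z ⊗ A′)) x))))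
          where
          difference≈ : ((x · planeGen (Z ⊗ A)) +v (-v (x · planeGen (Z ⊗ A′)))) ≈ (0v ∥ ((x · (Z ⊗ A)) +v (-v (x · (Z ⊗ A′)))))
          difference≈ = ≈-trans (λ j → cong₂ _+_ (·-hcat x Z (Z ⊗ A) j) (trans (cong -_ (·-hcat x Z (Z ⊗ A′) j)) (∥-neg (x · Z) _ j)))
                          (≈-trans (∥-+ _ _ _ _) (∥-cong (λ j → -‿inverseʳ _) ≈-refl))

        N∩S-line = HasDim-1⇒line (proj₁ (proj₂ cond))

        p : Vect 6
        p = proj₁ N∩S-line

        p∈N∩S : (N ∩ S) p
        p∈N∩S = proj₂ (proj₂ (proj₂ N∩S-line) p) (⟨⟩-row (row p) 0F)

        -- N ∩ S = ⟨ (0 | s) ⟩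
        s : Vect 3
        s = snd₆ p

        p≈0∥s : p ≈ (0v ∥ s)
        p≈0∥s = ≈-trans (∥-split p) (∥-cong (S⇒fst₆≈0 (proj₂ p∈N∩S)) ≈-refl)

        s≢0 : Nonzero s
        s≢0 = ≉0⇒Nonzero λ s≈0 → Nonzero⇒≉0 (proj₁ (proj₂ N∩S-line)) (≈-trans p≈0∥s (≈-trans (∥-cong ≈-refl s≈0) 0∥0))

        0∥s∈N : N (0v ∥ s)
        0∥s∈N = ≐⟨⟩-resp {M = N-basis} N≐ p≈0∥s (proj₁ p∈N∩S)

        N∩S⇒multiple : ∀ {v} → (N ∩ S) v → ∃[ μ ] (v ≈ (μ *v p))
        N∩S⇒multiple v∈ = ⟨row⟩⇒multiple (proj₁ (proj₂ (proj₂ N∩S-line) _) v∈)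

        A₀-plane : ∃[ A ] (𝓡 A × ∃[ R′ ] (RowsIndependent R′ × ⟨ R′ ⟩ ≐ (E A ∩ H Z)))
        A₀-plane = A , A∈𝓡 , R′ , R′-ind , L≐
          where
          p∈⟨N-basis⟩ = proj₁ (N≐ p) (proj₁ p∈N∩S)
          c = proj₁ p∈⟨N-basis⟩
          c≢0 : Nonzero c
          c≢0 = ≉0⇒Nonzero λ c≈0 → Nonzero⇒≉0 (proj₁ (proj₂ N∩S-line))
                  (≈-trans (proj₂ p∈⟨N-basis⟩) (≈-trans (·-cong N-basis c≈0) (·-zeroˡ N-basis)))
          complement′ = complement-of-line N-basis N-basis-ind c c≢0
          R′ = proj₁ complement′
          R′-ind = proj₁ (proj₂ complement′)
          R′⊆N : ⟨ R′ ⟩ ⊆ N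
          R′⊆N v v∈ = proj₂ (N≐ v) (proj₁ (proj₂ (proj₂ complement′)) v v∈)
          R′∩S≈0 : ∀ v → ⟨ R′ ⟩ v → S v → v ≈ 0v
          R′∩S≈0 v v∈R′ v∈S = ≈-trans v≈μp (λ j → trans (cong (_* p j) μ≡0) (zeroˡ _))
            where
            μ = proj₁ (N∩S⇒multiple (R′⊆N v v∈R′ , v∈S))
            v≈μp = proj₂ (N∩S⇒multiple (R′⊆N v v∈R′ , v∈S))
            μ≡0 : μ ≡ 0#
            μ≡0 = proj₂ (proj₂ (proj₂ complement′)) μ v v∈R′ (≈-trans v≈μp (λ j → cong (μ *_) (proj₂ p∈⟨N-basis⟩ j)))
          realised = realise ⟨ R′ ⟩ (R′⊆N , HasDim-⟨⟩ R′ R′-ind , R′∩S≈0)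
          A = proj₁ realised
          A∈𝓡 = proj₁ (proj₂ realised)
          L≐ = proj₂ (proj₂ realised)

        A₀ : Mat 3 3
        A₀ = proj₁ A₀-plane

        A₀∈𝓡 : 𝓡 A₀
        A₀∈𝓡 = proj₁ (proj₂ A₀-plane)

        along : IsLineAlong (ZR Z 𝓡) (Z ⊗ A₀) s
        along M = to , from
          where
          to : ZR Z 𝓡 M → ∃[ μ ] (M ≈ₘ ((Z ⊗ A₀) +ₘ rowMultiples s μ))
          to (A , A∈𝓡 , M≈ZA) = (λ i → proj₁ (row-difference i)) , λ i j →
              trans (M≈ZA i j) (trans (sym (move ((Z ⊗ A₀) i j) ((Z ⊗ A) i j))) (cong ((Z ⊗ A₀) i j +_) (proj₂ (row-difference i) j)))
            where
            move : ∀ x y → (x + (y + (- x))) ≡ y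
            move = solve 2 (λ x y → x :+ (y :+ (:- x)) := y) refl
            row-difference : ∀ i → ∃[ μ ] (((Z ⊗ A) i +v (-v (Z ⊗ A₀) i)) ≈ (μ *v s))
            row-difference i = μ , λ j → trans (cong₂ (λ a b → a + (- b)) (sym (·-Iₘˡ i (Z ⊗ A) j)) (sym (·-Iₘˡ i (Z ⊗ A₀) j)))
                                                 (proj₂ halves j)
              where
              multiple = N∩S⇒multiple (0∥difference∈N A∈𝓡 A₀∈𝓡 (Iₘ i) , S-∥ _)
              μ = proj₁ multiple
              halves = ∥-injective (≈-trans (proj₂ multiple) (≈-trans (λ j → cong (μ *_) (p≈0∥s j)) (∥-* μ 0v s)))
          from : ∃[ μ ] (M ≈ₘ ((Z ⊗ A₀) +ₘ rowMultiples s μ)) → ZR Z 𝓡 M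
          from (μ , M≈) = A , A∈𝓡 , λ i j → trans (M≈ i j) (plane-injective (≐-trans plane≐ (E∩H≐plane A)) i j)
            where
            plane⊆N′ : plane ((Z ⊗ A₀) +ₘ rowMultiples s μ) ⊆ N
            plane⊆N′ v v∈ = NGen⊆N A₀∈𝓡 0∥s∈N v (plane⊆⟨NGen⟩ (Z ⊗ A₀) s μ v v∈)
            realised = realise _ (plane⊆N′ , plane-dim _ , plane∩S≈0 _)
            A = proj₁ realised
            A∈𝓡 = proj₁ (proj₂ realised)
            plane≐ = proj₂ (proj₂ realised)

      i⇒ii : CondI Z 𝓡 → CondII Z 𝓡
      i⇒ii (_ , cond) = Z ⊗ A₀ , ⟨ row s ⟩ , IsLineAlong⇒IsLineWith s≢0 along
        where open FromCondI cond

      module FromLine {B w} (w≢0 : Nonzero w) (along : IsLineAlong (ZR Z 𝓡) B w) where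

        base : ZR Z 𝓡 B
        base = proj₂ (along B) (0v , λ i j → sym (trans (cong (B i j +_) (zeroˡ (w j))) (+-identityʳ _)))

        A₀ : Mat 3 3
        A₀ = proj₁ base

        A₀∈𝓡 : 𝓡 A₀
        A₀∈𝓡 = proj₁ (proj₂ base)

        B≈ZA₀ : B ≈ₘ (Z ⊗ A₀)
        B≈ZA₀ = proj₂ (proj₂ base)

        step : ∀ t → ZR Z 𝓡 (B +ₘ rowMultiples w (Iₘ t))
        step t = proj₂ (along _) (Iₘ t , λ i j → refl)

        Ds : Fin 2 → Mat 3 3
        Ds t = proj₁ (step t) −ₘ A₀

        Ds⊆𝒜 : ∀ t → 𝒜 (Ds t)
        Ds⊆𝒜 t = 𝒜-− (𝓡⊆𝒜 _ (proj₁ (proj₂ (step t)))) (𝓡⊆𝒜 _ A₀∈𝓡)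

        Z⊗Ds : ∀ t → (Z ⊗ Ds t) ≈ₘ rowMultiples w (Iₘ t)
        Z⊗Ds t i j = trans (Z⊗-−ₘ (proj₁ (step t)) A₀ i j)
                           (trans (cong₂ (λ x y → x + (- y)) (sym (proj₂ (proj₂ (step t)) i j)) (sym (B≈ZA₀ i j)))
                                  (solve 2 (λ x y → x :+ y :+ (:- x) := y) refl (B i j) _))

        Z⊗lincomb : ∀ c → (Z ⊗ lincombₘ c Ds) ≈ₘ rowMultiples w c
        Z⊗lincomb c i j = begin
            (Z ⊗ lincombₘ c Ds) i j               ≡⟨ Z⊗-lincomb c Ds i j ⟩
            ∑ (λ t → c t * (Z ⊗ Ds t) i j)        ≡⟨ ∑-cong (λ t → trans (cong (c t *_) (Z⊗Ds t i j)) (sym (*-assoc (c t) _ (w j)))) ⟩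
            ∑ (λ t → (c t * Iₘ t i) * w j)        ≡⟨ ∑-*ʳ (w j) (λ t → c t * Iₘ t i) ⟩
            ∑ (λ t → c t * Iₘ t i) * w j          ≡⟨ cong (_* w j) (∑-Iₘʳ i c) ⟩
            c i * w j                             ∎
          where open ≡-Reasoning

        Ds-independent : MatsIndependent Ds
        Ds-independent c e i = *v-cancelʳ-0 (c i) w≢0 λ j →
          trans (sym (Z⊗lincomb c i j)) (trans (Z⊗-cong e i j) (·-zeroʳ {n = 3} (Z i) j))

        span⊆𝒜 : MatSpan Ds ⊆ₘ 𝒜
        span⊆𝒜 D (c , D≈) = 𝒜-resp (λ i j → sym (D≈ i j)) (𝒜-lincomb c Ds Ds⊆𝒜)

        𝓡≐A₀+span : ∀ M → (𝓡 M → ∃[ D ] (MatSpan Ds D × M ≈ₘ (A₀ +ₘ D))) × (∃[ D ] (MatSpan Ds D × M ≈ₘ (A₀ +ₘ D)) → 𝓡 M)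
        𝓡≐A₀+span M = to , from
          where
          to : 𝓡 M → ∃[ D ] (MatSpan Ds D × M ≈ₘ (A₀ +ₘ D))
          to M∈𝓡 = lincombₘ μ Ds , (μ , λ i j → refl)
                 , Z⊗-injective (𝓡⊆𝒜 M M∈𝓡) (𝒜-+ (𝓡⊆𝒜 _ A₀∈𝓡) (𝒜-lincomb μ Ds Ds⊆𝒜)) ZM≈
            where
            on-line = proj₁ (along (Z ⊗ M)) (ZR-∈ M∈𝓡)
            μ = proj₁ on-line
            ZM≈ : (Z ⊗ M) ≈ₘ (Z ⊗ (A₀ +ₘ lincombₘ μ Ds))
            ZM≈ i j = trans (proj₂ on-line i j)
                            (trans (cong₂ _+_ (B≈ZA₀ i j) (sym (Z⊗lincomb μ i j))) (sym (Z⊗-+ₘ A₀ (lincombₘ μ Ds) i j)))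
          from : ∃[ D ] (MatSpan Ds D × M ≈ₘ (A₀ +ₘ D)) → 𝓡 M
          from (D , (c , D≈) , M≈) = 𝓡-resp (λ i j → sym (Z⊗-injective M∈𝒜 (𝓡⊆𝒜 A A∈𝓡) ZM≈ZA i j)) A∈𝓡
            where
            ZM≈ : (Z ⊗ M) ≈ₘ (B +ₘ rowMultiples w c)
            ZM≈ i j = trans (Z⊗-cong M≈ i j)
                            (trans (Z⊗-+ₘ A₀ D i j) (cong₂ _+_ (sym (B≈ZA₀ i j)) (trans (Z⊗-cong D≈ i j) (Z⊗lincomb c i j))))
            on-line = proj₂ (along (Z ⊗ M)) (c , ZM≈)
            A = proj₁ on-line
            A∈𝓡 = proj₁ (proj₂ on-line)
            ZM≈ZA = proj₂ (proj₂ on-line)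
            M∈𝒜 = 𝒜-resp (λ i j → sym (M≈ i j)) (𝒜-+ (𝓡⊆𝒜 _ A₀∈𝓡) (span⊆𝒜 D (c , D≈)))

        Z⊗span⊆⟨w⟩ : ∀ {D} → MatSpan Ds D → ∀ i → ⟨ row w ⟩ ((Z ⊗ D) i)
        Z⊗span⊆⟨w⟩ (c , D≈) i = ⟨⟩-resp {M = row w} (λ j → sym (trans (Z⊗-cong D≈ i j) (Z⊗lincomb c i j))) (⟨row⟩-multiple w (c i))

        span-rank-2 : ∀ D → MatSpan Ds D → ¬ (D ≈ₘ 0ₘ) → HasRank D 2
        span-rank-2 D D∈ D≉0 = subst (HasRank D) (ℕP.≤-antisym (HasRank-≤-suc Z Z-independent D (row w) (Z⊗span⊆⟨w⟩ D∈) rank-d) 2≤d) rank-d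
          where
          rank = 𝒜-rank D (span⊆𝒜 D D∈) D≉0
          2≤d = proj₁ (proj₂ rank)
          rank-d = proj₂ (proj₂ rank)

        Ds-∈span : ∀ t → MatSpan Ds (Ds t)
        Ds-∈span t = Iₘ t , λ i j → sym (∑-Iₘˡ t (λ t′ → Ds t′ i j))

        Ds-≉0 : ∀ t → ¬ (Ds t ≈ₘ 0ₘ)
        Ds-≉0 t Dₜ≈0 = Nonzero⇒≉0 w≢0 λ j →
          trans (sym (*-identityˡ (w j))) (trans (cong (_* w j) (sym (Iₘ-diag t)))
                (trans (sym (Z⊗Ds t t j)) (trans (Z⊗-cong Dₜ≈0 t j) (·-zeroʳ {n = 3} (Z t) j))))

        kernels-span-Z : Span (LeftKernelVectors Ds) ≐ ⟨ Z ⟩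
        kernels-span-Z v = to , from
          where
          kernel⊆Z : ∀ {z} → LeftKernelVectors Ds z → ⟨ Z ⟩ z
          kernel⊆Z (D , D∈ , D≉0 , z·D≈0) =
            LeftKer⊆⟨⟩ Z Z-independent D (row w) (Z⊗span⊆⟨w⟩ D∈) (span-rank-2 D D∈ D≉0) (s≤s (s≤s ℕ.z≤n)) _ z·D≈0
          to : Span (LeftKernelVectors Ds) v → ⟨ Z ⟩ v
          to (k , zs , zs∈ , v∈) = ⟨⟩-mono {M = zs} {N = Z} (λ i → kernel⊆Z (zs∈ i)) v v∈
          other : Fin 2 → Fin 2
          other 0F = 1F
          other 1F = 0F
          other≢ : ∀ i → ¬ (other i ≡ i)
          other≢ 0F ()
          other≢ 1F ()
          Zᵢ∈ : ∀ i → LeftKernelVectors Ds (Z i)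
          Zᵢ∈ i = Ds (other i) , Ds-∈span (other i) , Ds-≉0 (other i) , λ j →
            trans (Z⊗Ds (other i) i j) (trans (cong (_* w j) (Iₘ-off (other i) i (other≢ i))) (zeroˡ _))
          from : ⟨ Z ⟩ v → Span (LeftKernelVectors Ds) v
          from v∈Z = 2 , Z , Zᵢ∈ , v∈Z

      along⇒CondIII : ∀ {B w} → Nonzero w → IsLineAlong (ZR Z 𝓡) B w → CondIII 𝒜 Z 𝓡
      along⇒CondIII w≢0 along =
        A₀ , Ds , 𝓡⊆𝒜 A₀ A₀∈𝓡 , Ds-independent , span⊆𝒜 , 𝓡≐A₀+span , span-rank-2 , kernels-span-Z
        where open FromLine w≢0 along

      module FromCondIII (A₀ : Mat 3 3) (Ds : Fin 2 → Mat 3 3) (h : CondIIIWith 𝒜 Z 𝓡 A₀ Ds) where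

        Ds-independent : MatsIndependent Ds
        Ds-independent = proj₁ (proj₂ h)

        span⊆𝒜 : MatSpan Ds ⊆ₘ 𝒜
        span⊆𝒜 = proj₁ (proj₂ (proj₂ h))

        𝓡≐A₀+span : ∀ M → (𝓡 M → ∃[ D ] (MatSpan Ds D × M ≈ₘ (A₀ +ₘ D))) × (∃[ D ] (MatSpan Ds D × M ≈ₘ (A₀ +ₘ D)) → 𝓡 M)
        𝓡≐A₀+span = proj₁ (proj₂ (proj₂ (proj₂ h)))

        span-rank-2 : ∀ D → MatSpan Ds D → ¬ (D ≈ₘ 0ₘ) → HasRank D 2
        span-rank-2 = proj₁ (proj₂ (proj₂ (proj₂ (proj₂ h))))

        kernels-span-Z : Span (LeftKernelVectors Ds) ≐ ⟨ Z ⟩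
        kernels-span-Z = proj₂ (proj₂ (proj₂ (proj₂ (proj₂ h))))

        lincomb∈span : ∀ c → MatSpan Ds (lincombₘ c Ds)
        lincomb∈span c = c , λ i j → refl

        Ds-∈span : ∀ t → MatSpan Ds (Ds t)
        Ds-∈span t = Iₘ t , λ i j → sym (∑-Iₘˡ t (λ t′ → Ds t′ i j))

        Ds-≉0 : ∀ t → ¬ (Ds t ≈ₘ 0ₘ)
        Ds-≉0 t Dₜ≈0 = 1≢0 (trans (sym (Iₘ-diag t)) (Ds-independent (Iₘ t) (λ i j → trans (∑-Iₘˡ t (λ t′ → Ds t′ i j)) (Dₜ≈0 i j)) t))

        A₀+span⊆𝓡 : ∀ {D} → MatSpan Ds D → 𝓡 (A₀ +ₘ D)
        A₀+span⊆𝓡 {D} D∈ = proj₂ (𝓡≐A₀+span (A₀ +ₘ D)) (D , D∈ , λ i j → refl)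

        A₀∈𝓡 : 𝓡 A₀
        A₀∈𝓡 = proj₂ (𝓡≐A₀+span A₀) (0ₘ , (0v , λ i j → sym (∑-0 (λ t → 0# * Ds t i j) (λ t → zeroˡ _))) , λ i j → sym (+-identityʳ _))

        LeftKer⊆⟨Z⟩ : ∀ {D} → MatSpan Ds D → ¬ (D ≈ₘ 0ₘ) → ∀ z → LeftKer D z → ⟨ Z ⟩ z
        LeftKer⊆⟨Z⟩ {D} D∈ D≉0 z z·D≈0 =
          proj₁ (kernels-span-Z z) (1 , row z , (λ _ → D , D∈ , D≉0 , z·D≈0) , (λ _ → 1#) , λ j → sym (trans (+-identityʳ _) (*-identityˡ _)))

        Z⊗span-≉0 : ∀ {D} → MatSpan Ds D → ¬ (D ≈ₘ 0ₘ) → ¬ ((Z ⊗ D) ≈ₘ 0ₘ)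
        Z⊗span-≉0 {D} D∈ D≉0 ZD≈0 = ℕP.<⇒≱ (s≤s (s≤s ℕ.z≤n)) (HasRank-≤-1 Z Z-independent D ZD≈0 (span-rank-2 D D∈ D≉0))

        Z⊗span-LeftKer≢0 : ∀ {D} → MatSpan Ds D → ¬ (D ≈ₘ 0ₘ) → ∃[ x ] (Nonzero x × (x · (Z ⊗ D)) ≈ 0v)
        Z⊗span-LeftKer≢0 {D} D∈ D≉0 = x , x≢0 , ≈-trans (·-⊗ x Z D) (≈-trans (·-cong D (≈-sym (proj₂ z∈⟨Z⟩))) (proj₂ (proj₂ kernel)))
          where
          kernel = HasRank-<⇒LeftKer≢0 D (span-rank-2 D D∈ D≉0) (s≤s (s≤s (s≤s ℕ.z≤n)))
          z∈⟨Z⟩ = LeftKer⊆⟨Z⟩ D∈ D≉0 (proj₁ kernel) (proj₂ (proj₂ kernel))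
          x = proj₁ z∈⟨Z⟩
          x≢0 : Nonzero x
          x≢0 = ≉0⇒Nonzero λ x≈0 → Nonzero⇒≉0 (proj₁ (proj₂ kernel)) (≈-trans (proj₂ z∈⟨Z⟩) (≈-trans (·-cong Z x≈0) (·-zeroˡ Z)))

        Z⊗span-rank-1 : ∀ {D} → MatSpan Ds D → ¬ (D ≈ₘ 0ₘ) → ∃[ r ] ∃[ α ] (Nonzero r × (Z ⊗ D) ≈ₘ rowMultiples r α)
        Z⊗span-rank-1 {D} D∈ D≉0 =
          2×n-rank-1 (Z ⊗ D) (proj₁ kernel) (proj₁ (proj₂ kernel)) (proj₂ (proj₂ kernel)) (Z⊗span-≉0 D∈ D≉0)
          where
          kernel = Z⊗span-LeftKer≢0 D∈ D≉0

        -- a common kernel vector k would force every kernel vector into ⟨ k ⟩, while they span ⟨ Z ⟩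
        no-common-kernel : ∀ k → Nonzero k → (∀ D → MatSpan Ds D → LeftKer D k) → ⊥
        no-common-kernel k k≢0 k-kills = ℕP.<⇒≱ (s≤s (s≤s ℕ.z≤n)) (independent-⊆⟨⟩⇒≤ Z (row k) Z-independent Zᵢ∈⟨k⟩)
          where
          kernel⊆⟨k⟩ : ∀ {z} → LeftKernelVectors Ds z → ⟨ row k ⟩ z
          kernel⊆⟨k⟩ {z} (D , D∈ , D≉0 , z·D≈0) with ⟨ row k ⟩? z
          ... | yes z∈⟨k⟩ = z∈⟨k⟩
          ... | no z∉⟨k⟩ = ⊥-elim (ℕP.<⇒≱ (s≤s (s≤s ℕ.z≤n))
                  (HasRank-≤-1 (pair k z) (pair-independent k z k≢0 z∉⟨k⟩) D
                               (λ { 0F j → k-kills D D∈ j ; 1F j → z·D≈0 j }) (span-rank-2 D D∈ D≉0)))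
          Zᵢ∈⟨k⟩ : ∀ i → ⟨ row k ⟩ (Z i)
          Zᵢ∈⟨k⟩ i = ⟨⟩-mono {M = proj₁ (proj₂ spanned)} {N = row k} (λ i′ → kernel⊆⟨k⟩ (proj₁ (proj₂ (proj₂ spanned)) i′)) (Z i)
                             (proj₂ (proj₂ (proj₂ spanned)))
            where
            spanned = proj₂ (kernels-span-Z (Z i)) (⟨⟩-row Z i)

        rank-1₀ = Z⊗span-rank-1 (Ds-∈span 0F) (Ds-≉0 0F)
        rank-1₁ = Z⊗span-rank-1 (Ds-∈span 1F) (Ds-≉0 1F)

        r₀ r₁ : Vect 3
        r₀ = proj₁ rank-1₀
        r₁ = proj₁ rank-1₁

        α β : Vect 2
        α = proj₁ (proj₂ rank-1₀)
        β = proj₁ (proj₂ rank-1₁)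

        r₀≢0 : Nonzero r₀
        r₀≢0 = proj₁ (proj₂ (proj₂ rank-1₀))

        Z⊗lincomb≈ : ∀ c i j → (Z ⊗ lincombₘ c Ds) i j ≡ ((c 0F * (α i * r₀ j)) + ((c 1F * (β i * r₁ j)) + 0#))
        Z⊗lincomb≈ c i j = trans (Z⊗-lincomb c Ds i j)
          (cong₂ (λ u v → (c 0F * u) + ((c 1F * v) + 0#)) (proj₂ (proj₂ (proj₂ rank-1₀)) i j) (proj₂ (proj₂ (proj₂ rank-1₁)) i j))

        -- otherwise a left kernel vector x of Z (D₀ + D₁) makes x Z a left kernel vector of both D₀ and D₁
        r₁∈⟨r₀⟩ : ⟨ row r₀ ⟩ r₁
        r₁∈⟨r₀⟩ = decidable-stable (⟨ row r₀ ⟩? r₁) r₁∉⟨r₀⟩⇒⊥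
          where
          r₁∉⟨r₀⟩⇒⊥ : ¬ ¬ (⟨ row r₀ ⟩ r₁)
          r₁∉⟨r₀⟩⇒⊥ r₁∉ = no-common-kernel k k≢0 k-kills
            where
            one : Vect 2
            one _ = 1#
            sum∈span = lincomb∈span one
            sum≉0 : ¬ (lincombₘ one Ds ≈ₘ 0ₘ)
            sum≉0 sum≈0 = 1≢0 (Ds-independent one sum≈0 0F)
            kernel = Z⊗span-LeftKer≢0 sum∈span sum≉0
            x = proj₁ kernel
            Z⊗sum≈ : (Z ⊗ lincombₘ one Ds) ≈ₘ (rowMultiples r₀ α +ₘ rowMultiples r₁ β)
            Z⊗sum≈ i j = trans (Z⊗lincomb≈ one i j) (cong₂ _+_ (*-identityˡ _) (trans (+-identityʳ _) (*-identityˡ _)))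
            d : Vect 2
            d 0F = dot x α
            d 1F = dot x β
            d·r≈0 : (d · pair r₀ r₁) ≈ 0v
            d·r≈0 j = trans (cong ((dot x α * r₀ j) +_) (+-identityʳ _))
                        (trans (sym (cong₂ _+_ (·-rowMultiples r₀ α x j) (·-rowMultiples r₁ β x j)))
                          (trans (sym (·-+ₘ x (rowMultiples r₀ α) (rowMultiples r₁ β) j)) (trans (sym (·-congₘ x Z⊗sum≈ j)) (proj₂ (proj₂ kernel) j))))
            d≈0 = pair-independent r₀ r₁ r₀≢0 r₁∉ d d·r≈0
            k = x · Z
            k≢0 : Nonzero k
            k≢0 = ≉0⇒Nonzero λ k≈0 → Nonzero⇒≉0 (proj₁ (proj₂ kernel)) (Z-independent x k≈0)
            k-kills-Ds : ∀ t → LeftKer (Ds t) k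
            k-kills-Ds 0F j = trans (sym (·-⊗ x Z (Ds 0F) j)) (trans (·-congₘ x (proj₂ (proj₂ (proj₂ rank-1₀))) j)
                                (trans (·-rowMultiples r₀ α x j) (trans (cong (_* r₀ j) (d≈0 0F)) (zeroˡ _))))
            k-kills-Ds 1F j = trans (sym (·-⊗ x Z (Ds 1F) j)) (trans (·-congₘ x (proj₂ (proj₂ (proj₂ rank-1₁))) j)
                                (trans (·-rowMultiples r₁ β x j) (trans (cong (_* r₁ j) (d≈0 1F)) (zeroˡ _))))
            k-kills : ∀ D → MatSpan Ds D → LeftKer D k
            k-kills D (c , D≈) j = trans (·-congₘ k D≈ j) (trans (·-lincombₘ k c Ds j)
                                     (∑-0 _ (λ t → trans (cong (c t *_) (k-kills-Ds t j)) (zeroʳ _))))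

        G : Mat 2 2
        G 0F = α
        G 1F = λ i → β i * proj₁ (⟨row⟩⇒multiple r₁∈⟨r₀⟩)

        Z⊗lincomb-along : ∀ c → (Z ⊗ lincombₘ c Ds) ≈ₘ rowMultiples r₀ (c · G)
        Z⊗lincomb-along c i j = trans (Z⊗lincomb≈ c i j)
          (trans (cong (λ v → (c 0F * (α i * r₀ j)) + ((c 1F * (β i * v)) + 0#)) (proj₂ (⟨row⟩⇒multiple r₁∈⟨r₀⟩) j))
                 (solve 6 (λ c₀ c₁ a b l r → c₀ :* (a :* r) :+ (c₁ :* (b :* (l :* r)) :+ con (ℤ.+ 0))
                                            := (c₀ :* a :+ (c₁ :* (b :* l) :+ con (ℤ.+ 0))) :* r)
                        refl (c 0F) (c 1F) (α i) (β i) _ (r₀ j)))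

        G-independent : RowsIndependent G
        G-independent c c·G≈0 = Ds-independent c (Z⊗≈0⇒≈0 (span⊆𝒜 _ (lincomb∈span c))
          (λ i j → trans (Z⊗lincomb-along c i j) (trans (cong (_* r₀ j) (c·G≈0 i)) (zeroˡ _))))

        along : IsLineAlong (ZR Z 𝓡) (Z ⊗ A₀) r₀
        along M = to , from
          where
          to : ZR Z 𝓡 M → ∃[ μ ] (M ≈ₘ ((Z ⊗ A₀) +ₘ rowMultiples r₀ μ))
          to (A , A∈𝓡 , M≈ZA) = c · G , λ i j →
              trans (M≈ZA i j) (trans (Z⊗-cong A≈ i j) (trans (Z⊗-+ₘ A₀ D i j)
                (cong ((Z ⊗ A₀) i j +_) (trans (Z⊗-cong D≈ i j) (Z⊗lincomb-along c i j)))))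
            where
            decomposed = proj₁ (𝓡≐A₀+span A) A∈𝓡
            D = proj₁ decomposed
            c = proj₁ (proj₁ (proj₂ decomposed))
            D≈ = proj₂ (proj₁ (proj₂ decomposed))
            A≈ = proj₂ (proj₂ decomposed)
          from : ∃[ μ ] (M ≈ₘ ((Z ⊗ A₀) +ₘ rowMultiples r₀ μ)) → ZR Z 𝓡 M
          from (μ , M≈) = A₀ +ₘ lincombₘ c Ds , A₀+span⊆𝓡 (lincomb∈span c) , λ i j →
              trans (M≈ i j) (trans (cong ((Z ⊗ A₀) i j +_) (trans (cong (_* r₀ j) (μ≈c·G i)) (sym (Z⊗lincomb-along c i j))))
                                    (sym (Z⊗-+ₘ A₀ (lincombₘ c Ds) i j)))
            where
            c = proj₁ (independent-square-spans G G-independent μ)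
            μ≈c·G = proj₂ (independent-square-spans G G-independent μ)

        ZR-line : CondII Z 𝓡
        ZR-line = Z ⊗ A₀ , ⟨ row r₀ ⟩ , IsLineAlong⇒IsLineWith r₀≢0 along

        commonRowGen : ∃[ s ] CommonRowGen Z Ds s
        commonRowGen = r₀ , Nonzero⇒≉0 r₀≢0 , λ D (c , D≈) ZD≉0 → ≐-trans (⟨⟩-congₘ (Z⊗D≈ {D} {c} D≈))
          (⟨rowMultiples⟩≐⟨row⟩ r₀ (c · G) (≉0⇒Nonzero λ c·G≈0 → ZD≉0 λ i j → trans (Z⊗D≈ {D} {c} D≈ i j) (trans (cong (_* r₀ j) (c·G≈0 i)) (zeroˡ _))))
          where
          Z⊗D≈ : ∀ {D c} → D ≈ₘ lincombₘ c Ds → (Z ⊗ D) ≈ₘ rowMultiples r₀ (c · G)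
          Z⊗D≈ {c = c} D≈ i j = trans (Z⊗-cong D≈ i j) (Z⊗lincomb-along c i j)

        module WithGenerator (s : Vect 3) (crg : CommonRowGen Z Ds s) where

          s≢0 : Nonzero s
          s≢0 = ≉0⇒Nonzero (proj₁ crg)

          A₁ : Mat 3 3
          A₁ = A₀ +ₘ Ds 0F

          A₁∈𝓡 : 𝓡 A₁
          A₁∈𝓡 = A₀+span⊆𝓡 (Ds-∈span 0F)

          s∈⟨ZD₀⟩ : ⟨ Z ⊗ Ds 0F ⟩ s
          s∈⟨ZD₀⟩ = proj₂ (proj₂ crg (Ds 0F) (Ds-∈span 0F) (Z⊗span-≉0 (Ds-∈span 0F) (Ds-≉0 0F)) s) (⟨⟩-row (row s) 0F)

          ZD₀≈ZA₁-ZA₀ : ∀ i j → (Z ⊗ Ds 0F) i j ≡ ((Z ⊗ A₁) i j + (- (Z ⊗ A₀) i j))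
          ZD₀≈ZA₁-ZA₀ i j = trans (sym (solve 2 (λ x y → x :+ y :+ (:- x) := y) refl ((Z ⊗ A₀) i j) _))
                                  (cong (_+ (- (Z ⊗ A₀) i j)) (sym (Z⊗-+ₘ A₀ (Ds 0F) i j)))

          N-canonical : ∀ N → CondIWith Z 𝓡 N → (N ≐ ⟨ Nmat Z A₀ s ⟩) × ((N ∩ S) ≐ ⟨ pad s ⟩)
          N-canonical N cond = HasDim-basis (proj₁ cond) (NGen (Z ⊗ A₀) s) (NGen-independent (Z ⊗ A₀) s≢0) rows∈N
                             , HasDim-basis (proj₁ (proj₂ cond)) (pad s) (pad-independent s≢0) pad∈N∩S
            where
            open FromCondI cond using (N-basis; N≐; NGen⊆N; 0∥difference∈N)
            x = proj₁ s∈⟨ZD₀⟩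
            0∥s∈N : N (0v ∥ s)
            0∥s∈N = ≐⟨⟩-resp {M = N-basis} N≐ (∥-cong ≈-refl (≈-sym s≈)) (0∥difference∈N A₁∈𝓡 A₀∈𝓡 x)
              where
              s≈ : s ≈ ((x · (Z ⊗ A₁)) +v (-v (x · (Z ⊗ A₀))))
              s≈ j = trans (proj₂ s∈⟨ZD₀⟩ j) (trans (∑-cong (λ i → trans (cong (x i *_) (ZD₀≈ZA₁-ZA₀ i j))
                                                                         (trans (distribˡ (x i) _ _) (cong ((x i * (Z ⊗ A₁) i j) +_) (sym (-‿distribʳ-* (x i) _))))))
                                                    (trans (∑-+ (λ i → x i * (Z ⊗ A₁) i j) (λ i → - (x i * (Z ⊗ A₀) i j))) (cong ((x · (Z ⊗ A₁)) j +_) (∑-neg (λ i → x i * (Z ⊗ A₀) i j)))))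
            rows∈N : ∀ i → N (NGen (Z ⊗ A₀) s i)
            rows∈N i = NGen⊆N {A₀} {s} A₀∈𝓡 0∥s∈N _ (⟨⟩-row (NGen (Z ⊗ A₀) s) i)
            pad∈N∩S : ∀ i → (N ∩ S) (pad s i)
            pad∈N∩S 0F = ≐⟨⟩-resp {M = N-basis} N≐ (≈-sym (hcat-row 0ₘ (row s) 0F)) 0∥s∈N
                       , S-resp (≈-sym (hcat-row 0ₘ (row s) 0F)) (S-∥ s)

          pointAtInfinity : ∀ B W → IsLineWith (ZR Z 𝓡) B W → W ≐ ⟨ row s ⟩
          pointAtInfinity B W line = HasDim-basis (proj₁ line) (row s) (row-independent s≢0) (λ _ → s∈W)
            where
            line-along = IsLineWith⇒IsLineAlong line
            w = proj₁ line-along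
            W≐w = proj₁ (proj₂ (proj₂ line-along))
            along′ = proj₂ (proj₂ (proj₂ line-along))
            on-line₀ = proj₁ (along′ (Z ⊗ A₀)) (ZR-∈ A₀∈𝓡)
            on-line₁ = proj₁ (along′ (Z ⊗ A₁)) (ZR-∈ A₁∈𝓡)
            ZD₀-rows∈⟨w⟩ : ∀ i → ⟨ row w ⟩ ((Z ⊗ Ds 0F) i)
            ZD₀-rows∈⟨w⟩ i = ⟨⟩-resp {M = row w} (λ j → sym (ZD₀≈ j)) (⟨row⟩-multiple w (proj₁ on-line₁ i + (- proj₁ on-line₀ i)))
              where
              ZD₀≈ : ∀ j → (Z ⊗ Ds 0F) i j ≡ ((proj₁ on-line₁ i + (- proj₁ on-line₀ i)) * w j)
              ZD₀≈ j = trans (ZD₀≈ZA₁-ZA₀ i j) (trans (cong₂ (λ u v → u + (- v)) (proj₂ on-line₁ i j) (proj₂ on-line₀ i j))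
                             (solve 4 (λ b m₁ m₀ w → b :+ m₁ :* w :+ (:- (b :+ m₀ :* w)) := (m₁ :+ (:- m₀)) :* w)
                                    refl (B i j) (proj₁ on-line₁ i) (proj₁ on-line₀ i) (w j)))
            s∈W : W s
            s∈W = proj₂ (W≐w s) (⟨⟩-mono {M = Z ⊗ Ds 0F} {N = row w} ZD₀-rows∈⟨w⟩ s s∈⟨ZD₀⟩)

      ii⇒i : CondII Z 𝓡 → CondI Z 𝓡
      ii⇒i (B , _ , line) = ⟨ NGen B w ⟩ , along⇒CondIWith {B} {w} w≢0 along
        where
        w = proj₁ (IsLineWith⇒IsLineAlong line)
        w≢0 = proj₁ (proj₂ (IsLineWith⇒IsLineAlong line))
        along = proj₂ (proj₂ (proj₂ (IsLineWith⇒IsLineAlong line)))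

      ii⇒iii : CondII Z 𝓡 → CondIII 𝒜 Z 𝓡
      ii⇒iii (_ , _ , line) = along⇒CondIII w≢0 along
        where
        w≢0 = proj₁ (proj₂ (IsLineWith⇒IsLineAlong line))
        along = proj₂ (proj₂ (proj₂ (IsLineWith⇒IsLineAlong line)))

      iii⇒ii : CondIII 𝒜 Z 𝓡 → CondII Z 𝓡
      iii⇒ii (A₀ , Ds , h) = FromCondIII.ZR-line A₀ Ds h

lemma10 : (K : FiniteField) → let open Over K in
    (𝒜 : MatSet 3 3) → IsLinearMRD332 𝒜 →
    (Z : Mat 2 3) → HasRank Z 2 → IsRREF Z →
    (𝓡 : MatSet 3 3) → RespectsMat 𝓡 → 𝓡 ⊆ₘ 𝒜 →
    -- (i) ⇔ (ii)
    ((CondI Z 𝓡 → CondII Z 𝓡) × (CondII Z 𝓡 → CondI Z 𝓡))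
    -- (ii) ⇔ (iii)
    × ((CondII Z 𝓡 → CondIII 𝒜 Z 𝓡) × (CondIII 𝒜 Z 𝓡 → CondII Z 𝓡))
    -- consequences, given witnesses A₀, 𝒟 = span Ds of (iii)
    × (∀ A₀ Ds → CondIIIWith 𝒜 Z 𝓡 A₀ Ds →
         (∃[ s ] CommonRowGen Z Ds s)
         × (∀ s → CommonRowGen Z Ds s →
              (∀ N → CondIWith Z 𝓡 N → (N ≐ ⟨ Nmat Z A₀ s ⟩) × ((N ∩ S) ≐ ⟨ pad s ⟩))
              × (∀ B W → IsLineWith (ZR Z 𝓡) B W → W ≐ ⟨ row s ⟩)))
lemma10 K 𝒜 mrd Z _ Z-rref 𝓡 𝓡-resp 𝓡⊆𝒜 =
    (i⇒ii , ii⇒i) , (ii⇒iii , iii⇒ii)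
  , λ A₀ Ds h → commonRowGen A₀ Ds h , λ s crg → N-canonical A₀ Ds h s crg , pointAtInfinity A₀ Ds h s crg
  where
  open MRDCodeLines K
  open MRDCode 𝒜 mrd Z Z-rref
  open Conditions 𝓡 𝓡-resp 𝓡⊆𝒜
  open FromCondIII using (commonRowGen)
  open FromCondIII.WithGenerator using (N-canonical; pointAtInfinity)
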